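{- Let $q$ be a prime power not divisible by $2$ or $3$, let $\lambda\in\mathbb{F}_q^\times$ with $27\lambda\neq1$, and let $E_\lambda$ be the projective closure in $\mathbb{P}^2$ of the affine curve $y^2+xy+y=\lambda x^3$ (i.e. the affine curve together with its point at infinity). Then $$|E_\lambda(\mathbb{F}_q)|=q+1-H_q(1/3,2/3;1,1\,|\,27\lambda).$$
   Context: Fix a nontrivial additive character $\psi_q$ of $\mathbb{F}_q$ and a generator $\omega$ of the character group of $\mathbb{F}_q^\times$; $g(m)=\sum_{x\in\mathbb{F}_q^\times}\omega(x)^m\psi_q(x)$. For hypergeometric data defined over $\mathbb{Q}$, i.e. $\prod_j\frac{X-e^{2\pi i\alpha_j}}{X-e^{2\pi i\beta_j}}=\frac{\prod_{i=1}^r(X^{p_i}-1)}{\prod_{j=1}^s(X^{q_j}-1)}$, one defines for $t\in\mathbb{F}_q^\times$ $$H_q(\alpha,\beta|t)=\frac{(-1)^{r+s}}{1-q}\sum_{m=0}^{q-2}q^{s(m)-s(0)}\prod_ig(p_im)\prod_jg(-q_jm)\,\omega(\epsilon M^{ -1}t)^m,$$ with $M=\prod p_i^{p_i}/\prod q_j^{q_j}$, $\epsilon=(-1)^{\sum q_j}$, and $s(m)$ the multiplicity of $e^{2\pi im/(q-1)}$ as a root of $\gcd(\prod_i(X^{p_i}-1),\prod_j(X^{q_j}-1))$. Here $\alpha=(1/3,2/3)$, $\beta=(1,1)$, so $p=(3)$, $q=(1,1,1)$, $M=27$, $\epsilon=-1$, the gcd is $X-1$ and $s(m)=1$ if $(q-1)\mid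 m$, else $0$; explicitly $H_q(1/3,2/3;1,1|t)=\frac{1}{1-q}\sum_{m=0}^{q-2}q^{s(m)-1}g(3m)g(-m)^3\,\omega(-t/27)^m$. -}

module Defs where

open import Level using (0ℓ)
open import Algebra.Bundles using (CommutativeRing)
open import Data.Nat as ℕ using (ℕ; zero; suc; _∸_; _<_)
open import Data.Nat.Divisibility using (_∣?_)
open import Data.Integer as ℤ using (ℤ; +_; -[1+_])
open import Data.Fin using (Fin)
open import Data.List using (List; []; _∷_; map; foldr; filter; tabulate; upTo; cartesianProduct; length)
open import Data.Product using (_×_; _,_; ∃)
open import Relation.Binary.PropositionalEquality using (_≡_)
open import Relation.Binary.Definitions using (Decidable)
open import Relation.Nullary using (¬_; does)
open import Relation.Nullary.Decidable using (¬?)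
open import Data.Bool using (if_then_else_)

-- A field (commutative ring with 0 ≠ 1 and inverses of nonzero elements;
-- the inverse is a total function whose value at 0 is irrelevant).

record Field : Set₁ where
  field
    cring : CommutativeRing 0ℓ 0ℓ
  open CommutativeRing cring public hiding (ring)
  field
    0≉1   : ¬ (0# ≈ 1#)
    inv   : Carrier → Carrier
    inv-r : ∀ x → ¬ (x ≈ 0#) → x * inv x ≈ 1#

  fromℕ : ℕ → Carrier
  fromℕ zero    = 0#
  fromℕ (suc n) = 1# + fromℕ n

  infixr 8 _^_ _^ᶻ_
  _^_ : Carrier → ℕ → Carrier
  x ^ zero  = 1#
  x ^ suc n = x * (x ^ n)

  _^ᶻ_ : Carrier → ℤ → Carrier
  x ^ᶻ (+ n)      = x ^ n
  x ^ᶻ (-[1+ n ]) = inv x ^ suc n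

  sumL : List Carrier → Carrier
  sumL = foldr _+_ 0#

record FiniteField (q : ℕ) : Set₁ where
  field
    fld : Field
  open Field fld public
  field
    _≟_       : Decidable _≈_
    enum      : Fin q → Carrier
    enum-inj  : ∀ i j → enum i ≈ enum j → i ≡ j
    enum-surj : ∀ x → ∃ λ i → enum i ≈ x

  elements : List Carrier
  elements = tabulate enum

  units : List Carrier
  units = filter (λ x → ¬? (x ≟ 0#)) elements

-- A field of characteristic zero (e.g. ℂ): the values of characters.
record Char0Field : Set₁ where
  field
    fld : Field
  open Field fld public
  field
    char0 : ∀ n → ¬ (fromℕ (suc n) ≈ 0#)

module _ {q : ℕ} (F : FiniteField q) (K : Char0Field) where
  private
    module F = FiniteField F
    module K = Char0Field K

  record AddChar : Set where
    field
      ψ       : F.Carrier → K.Carrier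
      ψ-cong  : ∀ {x y} → x F.≈ y → ψ x K.≈ ψ y
      ψ-0     : ψ F.0# K.≈ K.1#
      ψ-hom   : ∀ x y → ψ (x F.+ y) K.≈ ψ x K.* ψ y
      ψ-nontriv : ∃ λ x → ¬ (ψ x K.≈ K.1#)

  -- multiplicative character ω : F^× → K^× (given on nonzero elements)
  -- generating the character group of F^× (cyclic of order q-1), i.e.
  -- ω^k is nontrivial for 0 < k < q-1.
  record MulCharGen : Set where
    field
      ω       : F.Carrier → K.Carrier
      ω-cong  : ∀ {x y} → x F.≈ y → ω x K.≈ ω y
      ω-1     : ω F.1# K.≈ K.1#
      ω-hom   : ∀ x y → ¬ (x F.≈ F.0#) → ¬ (y F.≈ F.0#) →
                ω (x F.* y) K.≈ ω x K.* ω y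
      ω-gen   : ∀ k → 0 < k → k < q ∸ 1 →
                ∃ λ x → ¬ (x F.≈ F.0#) × ¬ ((ω x K.^ k) K.≈ K.1#)

  module _ (ψc : AddChar) (ωc : MulCharGen) where
    open AddChar ψc
    open MulCharGen ωc

    gauss : ℤ → K.Carrier
    gauss m = K.sumL (map (λ x → (ω x K.^ᶻ m) K.* ψ x) F.units)

    s : ℕ → ℕ
    s m = if does ((q ∸ 1) ∣? m) then 1 else 0

    -- H_q(1/3,2/3;1,1 | t)
    --  = 1/(1-q) Σ_{m=0}^{q-2} q^{s(m)-s(0)} g(3m) g(-m)^3 ω(ε M⁻¹ t)^m,
    -- with M = 27, ε = -1, (-1)^{r+s} = (-1)^4 = 1.
    H : F.Carrier → K.Carrier
    H t = K.inv (K.1# K.- K.fromℕ q) K.*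
          K.sumL (map term (upTo (q ∸ 1)))
      where
        arg : F.Carrier
        arg = (F.- F.1#) F.* F.inv (F.fromℕ 27) F.* t
        term : ℕ → K.Carrier
        term m = (K.fromℕ q K.^ᶻ (+ s m ℤ.- + s 0))
                 K.* gauss (+ (3 ℕ.* m))
                 K.* (gauss (ℤ.- (+ m)) K.^ 3)
                 K.* (ω arg K.^ m)

  -- |E_λ(F_q)|: affine solutions of y² + xy + y = λx³ plus the point at infinity
  pointCount : F.Carrier → ℕ
  pointCount lam =
    suc (length (filter (λ { (x , y) →
           ((y F.* y) F.+ (x F.* y) F.+ y) F.≟ (lam F.* (x F.* x F.* x)) })
         (cartesianProduct F.elements F.elements)))

{-# OPTIONS --safe #-}
module Submission where

-- Expanding the Gauss sums, g(3m) g(-m)³ ω(-λ)^m is a sum over x, y, z, w ∈ F^× of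
-- ψ(x + y + z + w) ω(-λx³/(yzw))^m.  Summed over 0 ≤ m < q - 1, orthogonality of the
-- powers of the generator ω forces w = -λx³/(yz); rescaling y, z by x turns what is left
-- into a sum of ψ(x σ(y,z)) with σ(y,z) = 1 + y + z - λ/(yz), and summing the additive
-- character over x counts the pairs of units with yz(1 + y + z) = λ.  The same count A
-- appears on the curve: the affine points with X ≠ 0 correspond to these pairs via
-- (X, Y) = (1/y, z/y), and X = 0 gives the two points Y = 0, -1.  Hence H = q - 2 - A
-- and |E(F_q)| = 3 + A.

open import Defs
open import Level using (Level; 0ℓ)
open import Algebra.Bundles using (CommutativeRing; CommutativeMonoid)
import Algebra.Properties.CommutativeMonoid.Sum
open import Data.Bool using (_∧_; if_then_else_)
open import Data.Bool.Properties using (∧-zeroʳ)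
open import Data.Empty using (⊥-elim)
open import Data.Fin as Fin using (Fin; punchIn)
open import Data.Fin.Properties using (punchInᵢ≢i; toℕ-injective; toℕ<n)
import Data.Fin.Permutation as Perm
open import Data.Integer as ℤ using (ℤ; +_; -[1+_])
import Data.Integer.Properties as ℤ
open import Data.List using ([]; _∷_; _++_; map; filter; length; tabulate; applyUpTo; cartesianProduct)
open import Data.List.Properties using (map-++; map-∘)
open import Data.Maybe using (Maybe; just; nothing)
open import Data.Nat as ℕ using (ℕ; zero; suc; _<?_)
import Data.Nat.Properties as ℕ
open import Data.Nat.Divisibility using (_∣_; divides; _∣?_; _∣0; ∣⇒≤)
open import Data.Product using (_,_; proj₁; proj₂; _×_)
open import Data.Sign as Sign using (Sign)
open import Data.Vec.Functional using (removeAt)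
open import Function using (_∘_)
open import Relation.Binary.Definitions using (tri<; tri≈; tri>)
open import Relation.Binary.PropositionalEquality as ≡ using (_≡_; _≢_)
open import Relation.Nullary using (¬_; yes; no; does; Dec)
open import Relation.Nullary.Decidable using (¬?; dec-true; dec-false)

module IntegerCoefficientSolver {c ℓ : Level} (R : CommutativeRing c ℓ) where
  open CommutativeRing R
  open import Algebra.Properties.Ring ring using (-0#≈0#; -‿involutive; -‿+-comm; -1*x≈-x)
  open import Algebra.Properties.Semiring.Mult.TCOptimised semiring using (1+×; ×-homo-+; ×1-homo-*) renaming (_×_ to _·_)
  open import Algebra.Properties.CommutativeSemigroup *-commutativeSemigroup using (interchange)
  open import Algebra.Solver.Ring.AlmostCommutativeRing
  open import Relation.Binary.Reasoning.Setoid setoid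

  ⟦_⟧ : ℤ → Carrier
  ⟦ + n ⟧      = n · 1#
  ⟦ -[1+ n ] ⟧ = - (suc n · 1#)

  ⟦⊖⟧ : ∀ m n → ⟦ m ℤ.⊖ n ⟧ ≈ m · 1# - n · 1#
  ⟦⊖⟧ zero    zero    = sym (-‿inverseʳ 0#)
  ⟦⊖⟧ zero    (suc n) = sym (+-identityˡ _)
  ⟦⊖⟧ (suc m) zero    = sym (trans (+-congˡ -0#≈0#) (+-identityʳ _))
  ⟦⊖⟧ (suc m) (suc n) = begin
    ⟦ suc m ℤ.⊖ suc n ⟧           ≡⟨ ≡.cong ⟦_⟧ (ℤ.[1+m]⊖[1+n]≡m⊖n m n) ⟩
    ⟦ m ℤ.⊖ n ⟧                   ≈⟨ ⟦⊖⟧ m n ⟩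
    m · 1# - n · 1#               ≈⟨ shift-by-1 ⟩
    (1# + m · 1#) - (1# + n · 1#) ≈⟨ sym (+-cong (1+× m 1#) (-‿cong (1+× n 1#))) ⟩
    suc m · 1# - suc n · 1#       ∎
    where
    shift-by-1 : m · 1# - n · 1# ≈ (1# + m · 1#) - (1# + n · 1#)
    shift-by-1 = begin
      m · 1# - n · 1#                 ≈⟨ +-congˡ (sym (+-identityˡ _)) ⟩
      m · 1# + (0# - n · 1#)          ≈⟨ +-congˡ (+-congʳ (sym (-‿inverseʳ 1#))) ⟩
      m · 1# + ((1# - 1#) - n · 1#)   ≈⟨ +-congˡ (+-assoc _ _ _) ⟩
      m · 1# + (1# + (- 1# - n · 1#)) ≈⟨ sym (+-assoc _ _ _) ⟩
      (m · 1# + 1#) + (- 1# - n · 1#) ≈⟨ +-cong (+-comm _ _) (-‿+-comm 1# _) ⟩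
      (1# + m · 1#) - (1# + n · 1#)   ∎

  ⟦⟧-homo-+ : ∀ i j → ⟦ i ℤ.+ j ⟧ ≈ ⟦ i ⟧ + ⟦ j ⟧
  ⟦⟧-homo-+ (+ m)      (+ n)      = ×-homo-+ 1# m n
  ⟦⟧-homo-+ (+ m)      -[1+ n ]   = ⟦⊖⟧ m (suc n)
  ⟦⟧-homo-+ -[1+ m ]   (+ n)      = trans (⟦⊖⟧ n (suc m)) (+-comm _ _)
  ⟦⟧-homo-+ -[1+ m ]   -[1+ n ]   = begin
    - (suc (suc (m ℕ.+ n)) · 1#)    ≡⟨ ≡.cong (λ k → - (suc k · 1#)) (≡.sym (ℕ.+-suc m n)) ⟩
    - ((suc m ℕ.+ suc n) · 1#)      ≈⟨ -‿cong (×-homo-+ 1# (suc m) (suc n)) ⟩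
    - (suc m · 1# + suc n · 1#)     ≈⟨ sym (-‿+-comm _ _) ⟩
    - (suc m · 1#) + - (suc n · 1#) ∎

  ⟦_⟧ˢ : Sign → Carrier
  ⟦ Sign.+ ⟧ˢ = 1#
  ⟦ Sign.- ⟧ˢ = - 1#

  ⟦◃⟧ : ∀ s n → ⟦ s ℤ.◃ n ⟧ ≈ ⟦ s ⟧ˢ * (n · 1#)
  ⟦◃⟧ s        zero    = sym (zeroʳ _)
  ⟦◃⟧ Sign.+   (suc n) = sym (*-identityˡ _)
  ⟦◃⟧ Sign.-   (suc n) = sym (-1*x≈-x _)

  ⟦sign◃abs⟧ : ∀ i → ⟦ i ⟧ ≈ ⟦ ℤ.sign i ⟧ˢ * (ℤ.∣ i ∣ · 1#)
  ⟦sign◃abs⟧ (+ n)      = sym (*-identityˡ _)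
  ⟦sign◃abs⟧ -[1+ n ]   = sym (-1*x≈-x _)

  ⟦⟧ˢ-homo-* : ∀ s t → ⟦ s Sign.* t ⟧ˢ ≈ ⟦ s ⟧ˢ * ⟦ t ⟧ˢ
  ⟦⟧ˢ-homo-* Sign.+ t      = sym (*-identityˡ _)
  ⟦⟧ˢ-homo-* Sign.- Sign.+ = sym (*-identityʳ _)
  ⟦⟧ˢ-homo-* Sign.- Sign.- = sym (trans (-1*x≈-x _) (-‿involutive 1#))

  ⟦⟧-homo-* : ∀ i j → ⟦ i ℤ.* j ⟧ ≈ ⟦ i ⟧ * ⟦ j ⟧
  ⟦⟧-homo-* i j = begin
    ⟦ σ Sign.* τ ℤ.◃ a ℕ.* b ⟧                ≈⟨ ⟦◃⟧ (σ Sign.* τ) (a ℕ.* b) ⟩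
    ⟦ σ Sign.* τ ⟧ˢ * ((a ℕ.* b) · 1#)        ≈⟨ *-cong (⟦⟧ˢ-homo-* σ τ) (×1-homo-* a b) ⟩
    (⟦ σ ⟧ˢ * ⟦ τ ⟧ˢ) * ((a · 1#) * (b · 1#)) ≈⟨ interchange _ _ _ _ ⟩
    (⟦ σ ⟧ˢ * (a · 1#)) * (⟦ τ ⟧ˢ * (b · 1#)) ≈⟨ sym (*-cong (⟦sign◃abs⟧ i) (⟦sign◃abs⟧ j)) ⟩
    ⟦ i ⟧ * ⟦ j ⟧                             ∎
    where
    σ τ : Sign
    σ = ℤ.sign i
    τ = ℤ.sign j
    a b : ℕ
    a = ℤ.∣ i ∣
    b = ℤ.∣ j ∣

  ⟦⟧-homo-neg : ∀ i → ⟦ ℤ.- i ⟧ ≈ - ⟦ i ⟧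
  ⟦⟧-homo-neg (+ zero)  = sym -0#≈0#
  ⟦⟧-homo-neg (+ suc n) = refl
  ⟦⟧-homo-neg -[1+ n ]  = sym (-‿involutive _)

  homomorphism : ℤ.+-*-rawRing -Raw-AlmostCommutative⟶ fromCommutativeRing R
  homomorphism = record
    { ⟦_⟧ = ⟦_⟧ ; +-homo = ⟦⟧-homo-+ ; *-homo = ⟦⟧-homo-* ; -‿homo = ⟦⟧-homo-neg
    ; 0-homo = refl ; 1-homo = refl }

  ⟦⟧-≟ : ∀ i j → Maybe (⟦ i ⟧ ≈ ⟦ j ⟧)
  ⟦⟧-≟ i j with i ℤ.≟ j
  ... | yes ≡.refl = just refl
  ... | no _       = nothing

  open import Algebra.Solver.Ring ℤ.+-*-rawRing (fromCommutativeRing R) homomorphism ⟦⟧-≟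
    public using (solve; _:=_; _:+_; _:*_; :-_; _:-_; con; Polynomial)

  :1 : ∀ {k} → Polynomial k
  :1 = con (+ 1)

module FieldProperties (Fd : Field) where
  open Field Fd
  open import Relation.Binary.Reasoning.Setoid setoid
  open IntegerCoefficientSolver cring public using (solve; _:=_; _:+_; _:*_; :-_; _:-_; con; :1)
  open import Algebra.Properties.Ring (CommutativeRing.ring cring) public using (-0#≈0#; -‿involutive)

  1≉0 : 1# ≉ 0#
  1≉0 1≈0 = 0≉1 (sym 1≈0)

  inv-l : ∀ x → x ≉ 0# → inv x * x ≈ 1#
  inv-l x x≉0 = trans (*-comm _ _) (inv-r x x≉0)

  *-cancelˡ : ∀ {x a b} → x ≉ 0# → x * a ≈ x * b → a ≈ b
  *-cancelˡ {x} {a} {b} x≉0 xa≈xb = begin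
    a               ≈⟨ sym (*-identityˡ a) ⟩
    1# * a          ≈⟨ *-congʳ (sym (inv-l x x≉0)) ⟩
    (inv x * x) * a ≈⟨ *-assoc _ _ _ ⟩
    inv x * (x * a) ≈⟨ *-congˡ xa≈xb ⟩
    inv x * (x * b) ≈⟨ sym (*-assoc _ _ _) ⟩
    (inv x * x) * b ≈⟨ *-congʳ (inv-l x x≉0) ⟩
    1# * b          ≈⟨ *-identityˡ b ⟩
    b               ∎

  x*y≈0⇒y≈0 : ∀ {x y} → x ≉ 0# → x * y ≈ 0# → y ≈ 0#
  x*y≈0⇒y≈0 {x} x≉0 xy≈0 = *-cancelˡ x≉0 (trans xy≈0 (sym (zeroʳ x)))

  *-nonzero : ∀ {x y} → x ≉ 0# → y ≉ 0# → x * y ≉ 0#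
  *-nonzero x≉0 y≉0 xy≈0 = y≉0 (x*y≈0⇒y≈0 x≉0 xy≈0)

  inv-unique : ∀ {x y} → x ≉ 0# → x * y ≈ 1# → y ≈ inv x
  inv-unique {x} x≉0 xy≈1 = *-cancelˡ x≉0 (trans xy≈1 (sym (inv-r x x≉0)))

  inv-nonzero : ∀ {x} → x ≉ 0# → inv x ≉ 0#
  inv-nonzero {x} x≉0 inv≈0 = 1≉0 (trans (sym (inv-r x x≉0)) (trans (*-congˡ inv≈0) (zeroʳ x)))

  inv-cong : ∀ {x y} → x ≉ 0# → x ≈ y → inv x ≈ inv y
  inv-cong {x} {y} x≉0 x≈y =
    inv-unique (λ y≈0 → x≉0 (trans x≈y y≈0)) (trans (*-congʳ (sym x≈y)) (inv-r x x≉0))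

  inv-involutive : ∀ {x} → x ≉ 0# → inv (inv x) ≈ x
  inv-involutive {x} x≉0 = sym (inv-unique (inv-nonzero x≉0) (inv-l x x≉0))

  inv-distrib-* : ∀ {x y} → x ≉ 0# → y ≉ 0# → inv (x * y) ≈ inv x * inv y
  inv-distrib-* {x} {y} x≉0 y≉0 = sym (inv-unique (*-nonzero x≉0 y≉0) (begin
    (x * y) * (inv x * inv y) ≈⟨ solve 4 (λ a b c d → (a :* b) :* (c :* d) := (a :* c) :* (b :* d)) refl x y (inv x) (inv y) ⟩
    (x * inv x) * (y * inv y) ≈⟨ *-cong (inv-r x x≉0) (inv-r y y≉0) ⟩
    1# * 1#                   ≈⟨ *-identityˡ 1# ⟩
    1#                        ∎))

  ^-cong : ∀ {x y} n → x ≈ y → x ^ n ≈ y ^ n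
  ^-cong zero    x≈y = refl
  ^-cong (suc n) x≈y = *-cong x≈y (^-cong n x≈y)

  1^n≈1 : ∀ n → 1# ^ n ≈ 1#
  1^n≈1 zero    = refl
  1^n≈1 (suc n) = trans (*-identityˡ _) (1^n≈1 n)

  ^-distribʳ-* : ∀ x y n → (x * y) ^ n ≈ x ^ n * y ^ n
  ^-distribʳ-* x y zero    = sym (*-identityˡ 1#)
  ^-distribʳ-* x y (suc n) = trans (*-congˡ (^-distribʳ-* x y n))
    (solve 4 (λ a b c d → a :* b :* (c :* d) := a :* c :* (b :* d)) refl x y (x ^ n) (y ^ n))

  ^-homo-+ : ∀ x m n → x ^ (m ℕ.+ n) ≈ x ^ m * x ^ n
  ^-homo-+ x zero    n = sym (*-identityˡ _)
  ^-homo-+ x (suc m) n = trans (*-congˡ (^-homo-+ x m n)) (sym (*-assoc _ _ _))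

  ^-assoc : ∀ x m n → x ^ (m ℕ.* n) ≈ (x ^ m) ^ n
  ^-assoc x zero    n = sym (1^n≈1 n)
  ^-assoc x (suc m) n = begin
    x ^ (n ℕ.+ m ℕ.* n)   ≈⟨ ^-homo-+ x n (m ℕ.* n) ⟩
    x ^ n * x ^ (m ℕ.* n) ≈⟨ *-congˡ (^-assoc x m n) ⟩
    x ^ n * (x ^ m) ^ n   ≈⟨ sym (^-distribʳ-* x (x ^ m) n) ⟩
    (x * x ^ m) ^ n       ∎

  ^-nonzero : ∀ {x} n → x ≉ 0# → x ^ n ≉ 0#
  ^-nonzero zero    x≉0 = 1≉0
  ^-nonzero (suc n) x≉0 = *-nonzero x≉0 (^-nonzero n x≉0)

  fromℕ-homo-+ : ∀ m n → fromℕ (m ℕ.+ n) ≈ fromℕ m + fromℕ n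
  fromℕ-homo-+ zero    n = sym (+-identityˡ _)
  fromℕ-homo-+ (suc m) n = trans (+-congˡ (fromℕ-homo-+ m n)) (sym (+-assoc _ _ _))

  fromℕ-homo-* : ∀ m n → fromℕ (m ℕ.* n) ≈ fromℕ m * fromℕ n
  fromℕ-homo-* zero    n = sym (zeroˡ _)
  fromℕ-homo-* (suc m) n = trans (fromℕ-homo-+ n (m ℕ.* n))
    (trans (+-cong (sym (*-identityˡ _)) (fromℕ-homo-* m n)) (sym (distribʳ _ _ _)))

  x-1≉0 : ∀ {x} → x ≉ 1# → x - 1# ≉ 0#
  x-1≉0 {x} x≉1 x-1≈0 = x≉1 (begin
    x             ≈⟨ solve 1 (λ y → y := (y :- :1) :+ :1) refl x ⟩
    (x - 1#) + 1# ≈⟨ +-congʳ x-1≈0 ⟩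
    0# + 1#       ≈⟨ +-identityˡ 1# ⟩
    1#            ∎)

  c*x≈x⇒x≈0 : ∀ {c x} → c ≉ 1# → c * x ≈ x → x ≈ 0#
  c*x≈x⇒x≈0 {c} {x} c≉1 cx≈x = x*y≈0⇒y≈0 (x-1≉0 c≉1) (begin
    (c - 1#) * x ≈⟨ solve 2 (λ a b → (a :- :1) :* b := a :* b :- b) refl c x ⟩
    c * x - x    ≈⟨ +-congʳ cx≈x ⟩
    x - x        ≈⟨ -‿inverseʳ x ⟩
    0#           ∎)

  x*y≈1⇒x*[y*z]≈z : ∀ {x y} → x * y ≈ 1# → ∀ z → x * (y * z) ≈ z
  x*y≈1⇒x*[y*z]≈z xy≈1 z = trans (sym (*-assoc _ _ _)) (trans (*-congʳ xy≈1) (*-identityˡ z))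


module Char0FieldProperties (K : Char0Field) where
  open Char0Field K
  open FieldProperties fld using (*-nonzero; *-cancelˡ; solve; _:=_; _:+_; _:*_; :1)
  open import Algebra.Properties.Semiring.Sum semiring using (sum)
  open import Relation.Binary.Reasoning.Setoid setoid

  sum+[1+r]*c≉0 : ∀ {k c} → c ≉ 0# → (v : Fin k → Carrier) → (∀ i → v i * v i ≈ c * v i) →
                  ∀ r → sum v + fromℕ (suc r) * c ≉ 0#
  sum+[1+r]*c≉0 {zero}  c≉0 v v² r sum≈0 = *-nonzero (char0 r) c≉0 (trans (sym (+-identityˡ _)) sum≈0)
  sum+[1+r]*c≉0 {suc k} {c} c≉0 v v² r sum≈0 = v0≉c v0≈c
    where
    v0 rest : Carrier
    v0 = v Fin.zero
    rest = sum (v ∘ Fin.suc)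
    v0≉0 : v0 ≉ 0#
    v0≉0 v0≈0 = sum+[1+r]*c≉0 c≉0 (v ∘ Fin.suc) (v² ∘ Fin.suc) r (begin
      rest + fromℕ (suc r) * c        ≈⟨ +-congʳ (sym (trans (+-congʳ v0≈0) (+-identityˡ rest))) ⟩
      (v0 + rest) + fromℕ (suc r) * c ≈⟨ sum≈0 ⟩
      0#                              ∎)
    v0≈c : v0 ≈ c
    v0≈c = *-cancelˡ v0≉0 (trans (v² Fin.zero) (*-comm c v0))
    v0≉c : v0 ≉ c
    v0≉c v0≈c = sum+[1+r]*c≉0 c≉0 (v ∘ Fin.suc) (v² ∘ Fin.suc) (suc r) (begin
      rest + (1# + fromℕ (suc r)) * c ≈⟨ solve 3 (λ x y z → x :+ (:1 :+ y) :* z := (z :+ x) :+ y :* z) refl rest (fromℕ (suc r)) c ⟩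
      (c + rest) + fromℕ (suc r) * c  ≈⟨ +-congʳ (+-congʳ (sym v0≈c)) ⟩
      (v0 + rest) + fromℕ (suc r) * c ≈⟨ sum≈0 ⟩
      0#                              ∎)

module FiniteSums {m : ℕ} (F : FiniteField (suc m)) (M : CommutativeMonoid 0ℓ 0ℓ) where
  private
    module F = FiniteField F
    module F′ = FieldProperties F.fld
  open CommutativeMonoid M
  open import Algebra.Properties.CommutativeMonoid.Sum M
  open import Relation.Binary.Reasoning.Setoid setoid

  index : F.Carrier → Fin (suc m)
  index x = proj₁ (F.enum-surj x)

  enum-index : ∀ x → F.enum (index x) F.≈ x
  enum-index x = proj₂ (F.enum-surj x)

  enum-punchIn≉ : ∀ a j → F.enum (punchIn (index a) j) F.≉ a
  enum-punchIn≉ a j e = punchInᵢ≢i (index a) j (F.enum-inj _ _ (F.trans e (F.sym (enum-index a))))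

  Congruent : (F.Carrier → Carrier) → Set
  Congruent h = ∀ {x y} → x F.≈ y → h x ≈ h y

  except : F.Carrier → (F.Carrier → Carrier) → F.Carrier → Carrier
  except a h x = if does (x F.≟ a) then ε else h x

  except-≈ : ∀ {a h x} → x F.≈ a → except a h x ≈ ε
  except-≈ {a} {h} {x} x≈a with x F.≟ a
  ... | yes _   = refl
  ... | no x≉a = ⊥-elim (x≉a x≈a)

  except-≉ : ∀ {a h x} → x F.≉ a → except a h x ≈ h x
  except-≉ {a} {h} {x} x≉a with x F.≟ a
  ... | no _    = refl
  ... | yes x≈a = ⊥-elim (x≉a x≈a)

  except-cong : ∀ a h → Congruent h → Congruent (except a h)
  except-cong a h h-cong {x} {y} x≈y with x F.≟ a | y F.≟ a
  ... | yes _   | yes _   = refl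
  ... | no _    | no _    = h-cong x≈y
  ... | yes x≈a | no y≉a  = ⊥-elim (y≉a (F.trans (F.sym x≈y) x≈a))
  ... | no x≉a  | yes y≈a = ⊥-elim (x≉a (F.trans x≈y y≈a))

  -- Opaque, so that unification sees ∑ f instead of an unfolded Fin-sum.
  opaque
    ∑ : (F.Carrier → Carrier) → Carrier
    ∑ h = sum (h ∘ F.enum)

    ∑-def : ∀ h → ∑ h ≡ sum (h ∘ F.enum)
    ∑-def h = ≡.refl

    ∑-cong : ∀ {f g} → (∀ x → f x ≈ g x) → ∑ f ≈ ∑ g
    ∑-cong f≈g = sum-cong-≋ (λ i → f≈g (F.enum i))

    ∑-distrib : ∀ f g → ∑ (λ x → f x ∙ g x) ≈ ∑ f ∙ ∑ g
    ∑-distrib f g = ∑-distrib-+ (f ∘ F.enum) (g ∘ F.enum)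

    ∑-swap : ∀ (f : F.Carrier → F.Carrier → Carrier) → ∑ (λ x → ∑ (f x)) ≈ ∑ (λ y → ∑ (λ x → f x y))
    ∑-swap f = ∑-comm (λ i j → f (F.enum i) (F.enum j))

    sum-∑-swap : ∀ {n} (f : Fin n → F.Carrier → Carrier) → sum (λ j → ∑ (f j)) ≈ ∑ (λ x → sum (λ j → f j x))
    sum-∑-swap f = ∑-comm (λ j i → f j (F.enum i))

    ∑-reindex : (f g : F.Carrier → F.Carrier) →
                (∀ {x y} → x F.≈ y → f x F.≈ f y) → (∀ {x y} → x F.≈ y → g x F.≈ g y) →
                (∀ x → f (g x) F.≈ x) → (∀ x → g (f x) F.≈ x) →
                ∀ h → Congruent h → ∑ (h ∘ f) ≈ ∑ h
    ∑-reindex f g f-cong g-cong fg≈id gf≈id h h-cong = sym (begin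
      sum (h ∘ F.enum)                              ≈⟨ sum-permute (h ∘ F.enum) π ⟩
      sum (λ i → h (F.enum (index (f (F.enum i))))) ≈⟨ sum-cong-≋ (λ i → h-cong (enum-index (f (F.enum i)))) ⟩
      sum (h ∘ f ∘ F.enum)                          ∎)
      where
      index-inverse : ∀ (u v : F.Carrier → F.Carrier) → (∀ {x y} → x F.≈ y → u x F.≈ u y) →
                      (∀ x → u (v x) F.≈ x) → ∀ i → index (u (F.enum (index (v (F.enum i))))) ≡ i
      index-inverse u v u-cong uv≈id i =
        F.enum-inj _ _ (F.trans (enum-index _) (F.trans (u-cong (enum-index _)) (uv≈id _)))
      π : Perm.Permutation (suc m) (suc m)
      π = Perm.permutation (λ i → index (f (F.enum i))) (λ j → index (g (F.enum j)))
            (index-inverse f g f-cong fg≈id) (index-inverse g f g-cong gf≈id)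

    ∑-remove : ∀ a h → Congruent h → ∑ h ≈ h a ∙ ∑ (except a h)
    ∑-remove a h h-cong = begin
      sum (h ∘ F.enum)                                   ≈⟨ sum-remove (h ∘ F.enum) ⟩
      h (F.enum i) ∙ sum (removeAt (h ∘ F.enum) i)       ≈⟨ ∙-cong (h-cong (enum-index a)) (sum-cong-≋ h≈except) ⟩
      h a ∙ sum (removeAt (except a h ∘ F.enum) i)       ≈⟨ ∙-congˡ (sym (identityˡ _)) ⟩
      h a ∙ (ε ∙ sum (removeAt (except a h ∘ F.enum) i)) ≈⟨ ∙-congˡ (∙-congʳ (sym (except-≈ {a} {h} (enum-index a)))) ⟩
      h a ∙ (except a h (F.enum i) ∙ sum (removeAt (except a h ∘ F.enum) i)) ≈⟨ ∙-congˡ (sym (sum-remove (except a h ∘ F.enum))) ⟩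
      h a ∙ sum (except a h ∘ F.enum)                    ∎
      where
      i : Fin (suc m)
      i = index a
      h≈except : ∀ j → h (F.enum (punchIn i j)) ≈ except a h (F.enum (punchIn i j))
      h≈except j = sym (except-≉ {a} {h} (enum-punchIn≉ a j))

    ∑-except-const : ∀ a c → ∑ (except a (λ _ → c)) ≈ sum {m} (λ _ → c)
    ∑-except-const a c = begin
      sum (except a (λ _ → c) ∘ F.enum) ≈⟨ sum-remove (except a (λ _ → c) ∘ F.enum) ⟩
      except a (λ _ → c) (F.enum i) ∙ sum (removeAt (except a (λ _ → c) ∘ F.enum) i) ≈⟨ ∙-cong (except-≈ {a} (enum-index a)) (sum-cong-≋ except≈c) ⟩
      ε ∙ sum {m} (λ _ → c)             ≈⟨ identityˡ _ ⟩
      sum {m} (λ _ → c)                 ∎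
      where
      i : Fin (suc m)
      i = index a
      except≈c : ∀ j → except a (λ _ → c) (F.enum (punchIn i j)) ≈ c
      except≈c j = except-≉ {a} (enum-punchIn≉ a j)

  ∑-scale : ∀ {a} → a F.≉ F.0# → ∀ h → Congruent h → ∑ (λ y → h (a F.* y)) ≈ ∑ h
  ∑-scale {a} a≉0 = ∑-reindex (a F.*_) (F.inv a F.*_) F.*-congˡ F.*-congˡ
                      (F′.x*y≈1⇒x*[y*z]≈z (F.inv-r a a≉0)) (F′.x*y≈1⇒x*[y*z]≈z (F′.inv-l a a≉0))

  ∑-translate : ∀ a h → Congruent h → ∑ (λ y → h (y F.+ a)) ≈ ∑ h
  ∑-translate a = ∑-reindex (F._+ a) (F._- a) F.+-congʳ F.+-congʳ
                    (λ x → F′.solve 2 (λ y b → (y :- b) :+ b := y) F.refl x a)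
                    (λ x → F′.solve 2 (λ y b → (y :+ b) :- b := y) F.refl x a)
    where open F′ using (_:=_; _:+_; _:-_)

isLeast : ℕ → ℕ → ℕ → ℕ
isLeast a b c = if does (a <? b) ∧ does (a <? c) then 1 else 0

isLeast≡1 : ∀ {a b c} → a ℕ.< b → a ℕ.< c → isLeast a b c ≡ 1
isLeast≡1 {a} {b} {c} a<b a<c rewrite dec-true (a <? b) a<b | dec-true (a <? c) a<c = ≡.refl

isLeast≡0ˡ : ∀ {a b} c → b ℕ.< a → isLeast a b c ≡ 0
isLeast≡0ˡ {a} {b} c b<a rewrite dec-false (a <? b) (ℕ.<⇒≯ b<a) = ≡.refl

isLeast≡0ʳ : ∀ {a c} b → c ℕ.< a → isLeast a b c ≡ 0
isLeast≡0ʳ {a} {c} b c<a rewrite dec-false (a <? c) (ℕ.<⇒≯ c<a) | ∧-zeroʳ (does (a <? b)) = ≡.refl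

add₃ : ∀ {x y z u v w} → x ≡ u → y ≡ v → z ≡ w → x ℕ.+ (y ℕ.+ z) ≡ u ℕ.+ (v ℕ.+ w)
add₃ x≡u y≡v z≡w = ≡.cong₂ ℕ._+_ x≡u (≡.cong₂ ℕ._+_ y≡v z≡w)

isLeast-rotations : ∀ {a b c} → a ≢ b → b ≢ c → a ≢ c → isLeast a b c ℕ.+ (isLeast b c a ℕ.+ isLeast c a b) ≡ 1
isLeast-rotations {a} {b} {c} a≢b b≢c a≢c with ℕ.<-cmp a b | ℕ.<-cmp b c | ℕ.<-cmp a c
... | tri≈ _ a≡b _ | _ | _ = ⊥-elim (a≢b a≡b)
... | _ | tri≈ _ b≡c _ | _ = ⊥-elim (b≢c b≡c)
... | _ | _ | tri≈ _ a≡c _ = ⊥-elim (a≢c a≡c)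
... | tri< a<b _ _ | tri< b<c _ _ | tri> _ _ c<a = ⊥-elim (ℕ.<⇒≯ (ℕ.<-trans a<b b<c) c<a)
... | tri> _ _ b<a | tri> _ _ c<b | tri< a<c _ _ = ⊥-elim (ℕ.<⇒≯ (ℕ.<-trans c<b b<a) a<c)
... | tri< a<b _ _ | _ | tri< a<c _ _ = add₃ (isLeast≡1 a<b a<c) (isLeast≡0ʳ c a<b) (isLeast≡0ˡ b a<c)
... | tri> _ _ b<a | tri< b<c _ _ | _ = add₃ (isLeast≡0ˡ c b<a) (isLeast≡1 b<c b<a) (isLeast≡0ʳ a b<c)
... | _ | tri> _ _ c<b | tri> _ _ c<a = add₃ (isLeast≡0ʳ b c<a) (isLeast≡0ˡ a c<b) (isLeast≡1 c<a c<b)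

module OrbitsOfLengthThree {m : ℕ} (F : FiniteField (suc m)) where
  private module F = FiniteField F
  open FiniteSums F ℕ.+-0-commutativeMonoid
  open import Algebra.Properties.CommutativeMonoid.Sum ℕ.+-0-commutativeMonoid using (sum)

  ι : F.Carrier → ℕ
  ι x = Fin.toℕ (index x)

  ι-cong : ∀ {x y} → x F.≈ y → ι x ≡ ι y
  ι-cong {x} {y} x≈y = ≡.cong Fin.toℕ (F.enum-inj _ _ (F.trans (enum-index x) (F.trans x≈y (F.sym (enum-index y)))))

  ι-injective : ∀ {x y} → ι x ≡ ι y → x F.≈ y
  ι-injective {x} {y} ιx≡ιy =
    F.trans (F.sym (enum-index x)) (F.trans (F.reflexive (≡.cong F.enum (toℕ-injective ιx≡ιy))) (enum-index y))

  sum-ones : ∀ n → sum {n} (λ _ → 1) ≡ n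
  sum-ones zero    = ≡.refl
  sum-ones (suc n) = ≡.cong suc (sum-ones n)

  -- r counts each orbit {x, σ x, σ² x} exactly once, at its element of least index.
  3∣size : (σ : F.Carrier → F.Carrier) → (∀ {x y} → x F.≈ y → σ x F.≈ σ y) →
           (∀ x → σ (σ (σ x)) F.≈ x) → (∀ x → σ x F.≉ x) → 3 ∣ suc m
  3∣size σ σ-cong σ³≈id σx≉x = divides (∑ r) (begin
    suc m                                       ≡⟨ ≡.sym (sum-ones (suc m)) ⟩
    sum {suc m} (λ _ → 1)                       ≡⟨ ≡.sym (∑-def (λ _ → 1)) ⟩
    ∑ (λ _ → 1)                                 ≡⟨ ≡.sym (∑-cong {g = λ _ → 1} one-least-per-orbit) ⟩
    ∑ (λ x → r x ℕ.+ (r (σ x) ℕ.+ r (σ (σ x)))) ≡⟨ ∑-distrib r (λ x → r (σ x) ℕ.+ r (σ (σ x))) ⟩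
    ∑ r ℕ.+ ∑ (λ x → r (σ x) ℕ.+ r (σ (σ x)))   ≡⟨ ≡.cong (∑ r ℕ.+_) (∑-distrib (r ∘ σ) (r ∘ σ ∘ σ)) ⟩
    ∑ r ℕ.+ (∑ (r ∘ σ) ℕ.+ ∑ (r ∘ σ ∘ σ))       ≡⟨ ≡.cong₂ (λ u v → ∑ r ℕ.+ (u ℕ.+ v)) ∑r∘σ (≡.trans (∑-σ (r ∘ σ) (r-cong ∘ σ-cong)) ∑r∘σ) ⟩
    ∑ r ℕ.+ (∑ r ℕ.+ ∑ r)                       ≡⟨ ≡.cong (λ u → ∑ r ℕ.+ (∑ r ℕ.+ u)) (≡.sym (ℕ.+-identityʳ (∑ r))) ⟩
    3 ℕ.* ∑ r                                   ≡⟨ ℕ.*-comm 3 (∑ r) ⟩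
    ∑ r ℕ.* 3                                   ∎)
    where
    open ≡.≡-Reasoning
    r : F.Carrier → ℕ
    r x = isLeast (ι x) (ι (σ x)) (ι (σ (σ x)))
    r-cong : Congruent r
    r-cong x≈y = ≡.cong₂ (λ u v → isLeast u (proj₁ v) (proj₂ v)) (ι-cong x≈y)
                   (≡.cong₂ _,_ (ι-cong (σ-cong x≈y)) (ι-cong (σ-cong (σ-cong x≈y))))
    distinct : ∀ {x y} → x F.≉ y → ι x ≢ ι y
    distinct x≉y ιx≡ιy = x≉y (ι-injective ιx≡ιy)
    one-least-per-orbit : ∀ x → r x ℕ.+ (r (σ x) ℕ.+ r (σ (σ x))) ≡ 1
    one-least-per-orbit x
      rewrite ι-cong (σ³≈id x) | ι-cong (σ-cong (σ³≈id x)) =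
      isLeast-rotations (distinct (λ x≈σx → σx≉x x (F.sym x≈σx))) (distinct (λ σx≈σσx → σx≉x (σ x) (F.sym σx≈σσx)))
                      (distinct (λ x≈σσx → σx≉x (σ (σ x)) (F.trans (σ³≈id x) x≈σσx)))
    ∑-σ : ∀ h → Congruent h → ∑ (h ∘ σ) ≡ ∑ h
    ∑-σ = ∑-reindex σ (σ ∘ σ) σ-cong (σ-cong ∘ σ-cong) σ³≈id σ³≈id
    ∑r∘σ : ∑ (r ∘ σ) ≡ ∑ r
    ∑r∘σ = ∑-σ r r-cong

  fromℕ3≈0⇒3∣size : F.fromℕ 3 F.≈ F.0# → 3 ∣ suc m
  fromℕ3≈0⇒3∣size 3≈0 = 3∣size (F._+ F.1#) F.+-congʳ +1+1+1≈id +1≉id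
    where
    open FieldProperties F.fld using (solve; _:=_; _:+_; _:-_; con; :1; 1≉0)
    +1+1+1≈id : ∀ x → x F.+ F.1# F.+ F.1# F.+ F.1# F.≈ x
    +1+1+1≈id x = F.trans (solve 1 (λ y → y :+ :1 :+ :1 :+ :1 := y :+ (:1 :+ (:1 :+ (:1 :+ con (+ 0))))) F.refl x)
                    (F.trans (F.+-congˡ 3≈0) (F.+-identityʳ x))
    +1≉id : ∀ x → x F.+ F.1# F.≉ x
    +1≉id x x+1≈x = 1≉0 (F.trans (solve 2 (λ y o → o := (y :+ o) :- y) F.refl x F.1#)
                           (F.trans (F.+-congʳ x+1≈x) (F.-‿inverseʳ x)))

module CharacterSums (n : ℕ) (F : FiniteField (suc (suc n))) (K : Char0Field)
                     (ψc : AddChar F K) (ωc : MulCharGen F K) where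
  N q : ℕ
  N = suc n
  q = suc N
  module F = FiniteField F
  module K = Char0Field K
  open AddChar ψc
  open MulCharGen ωc
  module F′ = FieldProperties F.fld
  module K′ = FieldProperties K.fld
  open Char0FieldProperties K using (sum+[1+r]*c≉0)
  open FiniteSums F K.+-commutativeMonoid
  module Π = FiniteSums F K.*-commutativeMonoid
  open import Algebra.Properties.Semiring.Sum K.semiring using (sum; sum-cong-≋; *-distribˡ-sum; *-distribʳ-sum)
  module Prod = Algebra.Properties.CommutativeMonoid.Sum K.*-commutativeMonoid
  open K using (_≈_; _+_; _*_; -_; _-_; 0#; 1#; _^_)
  open import Relation.Binary.Reasoning.Setoid K.setoid

  sum-const : ∀ k c → sum {k} (λ _ → c) ≈ K.fromℕ k * c
  sum-const zero    c = K.sym (K.zeroˡ c)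
  sum-const (suc k) c = K.trans (K.+-cong (K.sym (K.*-identityˡ c)) (sum-const k c)) (K.sym (K.distribʳ _ _ _))

  ∑-const : ∀ c → ∑ (λ _ → c) ≈ K.fromℕ q * c
  ∑-const c = K.trans (K.reflexive (∑-def (λ _ → c))) (sum-const q c)

  ∑-*ˡ : ∀ c f → ∑ (λ x → c * f x) ≈ c * ∑ f
  ∑-*ˡ c f = K.trans (K.reflexive (∑-def _)) (K.sym (K.trans (K.*-congˡ (K.reflexive (∑-def f))) (*-distribˡ-sum c (f ∘ F.enum))))

  ∑-*ʳ : ∀ c f → ∑ (λ x → f x * c) ≈ ∑ f * c
  ∑-*ʳ c f = K.trans (K.reflexive (∑-def _)) (K.sym (K.trans (K.*-congʳ (K.reflexive (∑-def f))) (*-distribʳ-sum c (f ∘ F.enum))))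

  [_] : ∀ {P : Set} → Dec P → K.Carrier
  [ P? ] = if does P? then 1# else 0#

  []-yes : ∀ {P : Set} (P? : Dec P) → P → [ P? ] ≈ 1#
  []-yes (yes _) _  = K.refl
  []-yes (no ¬p) p = ⊥-elim (¬p p)

  []-no : ∀ {P : Set} (P? : Dec P) → ¬ P → [ P? ] ≈ 0#
  []-no (no _)  _  = K.refl
  []-no (yes p) ¬p = ⊥-elim (¬p p)

  []-cong : ∀ {P Q : Set} (P? : Dec P) (Q? : Dec Q) → (P → Q) → (Q → P) → [ P? ] ≈ [ Q? ]
  []-cong (yes _) (yes _) _   _   = K.refl
  []-cong (no _)  (no _)  _   _   = K.refl
  []-cong (yes p) (no ¬q) p→q _   = ⊥-elim (¬q (p→q p))
  []-cong (no ¬p) (yes q) _   q→p = ⊥-elim (¬p (q→p q))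

  -- Sums over F^× are written ∑ˣ f = ∑ (χ · f) with χ the indicator of F^×, so that
  -- restricting a sum to units becomes ring algebra.
  χ : F.Carrier → K.Carrier
  χ x = [ ¬? (x F.≟ F.0#) ]

  χ-cong : Congruent χ
  χ-cong x≈y = []-cong (¬? (_ F.≟ F.0#)) (¬? (_ F.≟ F.0#))
                 (λ x≉0 y≈0 → x≉0 (F.trans x≈y y≈0)) (λ y≉0 x≈0 → y≉0 (F.trans (F.sym x≈y) x≈0))

  χ-guard : ∀ {x a b} → (x F.≉ F.0# → a ≈ b) → χ x * a ≈ χ x * b
  χ-guard {x} a≈b with x F.≟ F.0#
  ... | yes _   = K.trans (K.zeroˡ _) (K.sym (K.zeroˡ _))
  ... | no x≉0 = K.*-congˡ (a≈b x≉0)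

  χ²≈χ : ∀ x → χ x * χ x ≈ χ x
  χ²≈χ x with x F.≟ F.0#
  ... | yes _ = K.zeroˡ 0#
  ... | no _  = K.*-identityˡ 1#

  χ-≉0 : ∀ {x} → x F.≉ F.0# → χ x ≈ 1#
  χ-≉0 x≉0 = []-yes (¬? (_ F.≟ F.0#)) x≉0

  except0≈χ* : ∀ f x → except F.0# f x ≈ χ x * f x
  except0≈χ* f x with x F.≟ F.0#
  ... | yes _ = K.sym (K.zeroˡ _)
  ... | no _  = K.sym (K.*-identityˡ _)

  ∑ˣ : (F.Carrier → K.Carrier) → K.Carrier
  ∑ˣ f = ∑ (λ x → χ x * f x)

  ∑ˣ-cong : ∀ {f g} → (∀ x → x F.≉ F.0# → f x ≈ g x) → ∑ˣ f ≈ ∑ˣ g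
  ∑ˣ-cong f≈g = ∑-cong (λ x → χ-guard (f≈g x))

  ∑≈f0+∑ˣ : ∀ f → Congruent f → ∑ f ≈ f F.0# + ∑ˣ f
  ∑≈f0+∑ˣ f f-cong = K.trans (∑-remove F.0# f f-cong) (K.+-congˡ (∑-cong (except0≈χ* f)))

  ∑ˣ≈∑-f0 : ∀ f → Congruent f → ∑ˣ f ≈ ∑ f - f F.0#
  ∑ˣ≈∑-f0 f f-cong = begin
    ∑ˣ f                     ≈⟨ K′.solve 2 (λ a b → b := (a :+ b) :- a) K.refl (f F.0#) (∑ˣ f) ⟩
    (f F.0# + ∑ˣ f) - f F.0# ≈⟨ K.+-congʳ (K.sym (∑≈f0+∑ˣ f f-cong)) ⟩
    ∑ f - f F.0#             ∎
    where open K′ using (_:=_; _:+_; _:-_)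

  ∑ˣ-const : ∀ c → ∑ˣ (λ _ → c) ≈ K.fromℕ N * c
  ∑ˣ-const c = begin
    ∑ (λ x → χ x * c)         ≈⟨ ∑-cong (λ x → K.sym (except0≈χ* (λ _ → c) x)) ⟩
    ∑ (except F.0# (λ _ → c)) ≈⟨ ∑-except-const F.0# c ⟩
    sum {N} (λ _ → c)         ≈⟨ sum-const N c ⟩
    K.fromℕ N * c             ∎

  ∑ˣ-*ˡ : ∀ c f → ∑ˣ (λ x → c * f x) ≈ c * ∑ˣ f
  ∑ˣ-*ˡ c f = K.trans (∑-cong (λ x → K′.solve 3 (λ a b d → a :* (b :* d) := b :* (a :* d)) K.refl (χ x) c (f x)))
                      (∑-*ˡ c (λ x → χ x * f x))
    where open K′ using (_:=_; _:*_)

  ∑ˣ-*ʳ : ∀ c f → ∑ˣ (λ x → f x * c) ≈ ∑ˣ f * c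
  ∑ˣ-*ʳ c f = K.trans (∑-cong (λ x → K.sym (K.*-assoc _ _ _))) (∑-*ʳ c (λ x → χ x * f x))

  UnitCongruent : (F.Carrier → K.Carrier) → Set
  UnitCongruent f = ∀ {x y} → x F.≉ F.0# → x F.≈ y → f x ≈ f y

  χ*-cong : ∀ {f} → UnitCongruent f → Congruent (λ x → χ x * f x)
  χ*-cong f-cong x≈y = K.trans (χ-guard (λ x≉0 → f-cong x≉0 x≈y)) (K.*-congʳ (χ-cong x≈y))

  ∑ˣ-scale : ∀ {a} → a F.≉ F.0# → ∀ f → UnitCongruent f → ∑ˣ (λ y → f (a F.* y)) ≈ ∑ˣ f
  ∑ˣ-scale {a} a≉0 f f-cong = begin
    ∑ (λ y → χ y * f (a F.* y))         ≈⟨ ∑-cong (λ y → K.*-congʳ (χ-scale y)) ⟩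
    ∑ (λ y → χ (a F.* y) * f (a F.* y)) ≈⟨ ∑-scale a≉0 (λ x → χ x * f x) (χ*-cong f-cong) ⟩
    ∑ (λ x → χ x * f x)                 ∎
    where
    χ-scale : ∀ y → χ y ≈ χ (a F.* y)
    χ-scale y = []-cong (¬? (y F.≟ F.0#)) (¬? ((a F.* y) F.≟ F.0#))
                  (F′.*-nonzero a≉0) (λ ay≉0 y≈0 → ay≉0 (F.trans (F.*-congˡ y≈0) (F.zeroʳ a)))

  ∑-δ : ∀ v f → Congruent f → ∑ (λ w → [ w F.≟ v ] * f w) ≈ f v
  ∑-δ v f f-cong = begin
    ∑ δf                   ≈⟨ ∑-remove v δf δf-cong ⟩
    δf v + ∑ (except v δf) ≈⟨ K.+-cong (K.trans (K.*-congʳ ([]-yes (v F.≟ v) F.refl)) (K.*-identityˡ _))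
                                       (K.trans (∑-cong off-v) (K.trans (∑-const 0#) (K.zeroʳ _))) ⟩
    f v + 0#               ≈⟨ K.+-identityʳ _ ⟩
    f v                    ∎
    where
    δf : F.Carrier → K.Carrier
    δf w = [ w F.≟ v ] * f w
    δf-cong : Congruent δf
    δf-cong w≈w′ = K.*-cong ([]-cong (_ F.≟ v) (_ F.≟ v) (F.trans (F.sym w≈w′)) (F.trans w≈w′)) (f-cong w≈w′)
    off-v : ∀ w → except v δf w ≈ 0#
    off-v w with w F.≟ v
    ... | yes _ = K.refl
    ... | no _  = K.zeroˡ _

  ∑ˣ-δ : ∀ {v} → v F.≉ F.0# → ∀ f → Congruent f → ∑ˣ (λ w → [ w F.≟ v ] * f w) ≈ f v
  ∑ˣ-δ {v} v≉0 f f-cong = begin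
    ∑ (λ w → χ w * ([ w F.≟ v ] * f w)) ≈⟨ ∑-cong (λ w → K′.solve 3 (λ a b d → a :* (b :* d) := b :* (a :* d)) K.refl (χ w) _ (f w)) ⟩
    ∑ (λ w → [ w F.≟ v ] * (χ w * f w)) ≈⟨ ∑-δ v (λ w → χ w * f w) (λ w≈w′ → K.*-cong (χ-cong w≈w′) (f-cong w≈w′)) ⟩
    χ v * f v                           ≈⟨ K.trans (K.*-congʳ (χ-≉0 v≉0)) (K.*-identityˡ _) ⟩
    f v                                 ∎
    where open K′ using (_:=_; _:*_)

  sum-∑ˣ-swap : ∀ {k} (f : Fin k → F.Carrier → K.Carrier) → sum (λ j → ∑ˣ (f j)) ≈ ∑ˣ (λ x → sum (λ j → f j x))
  sum-∑ˣ-swap f = K.trans (sum-∑-swap (λ j x → χ x * f j x)) (∑-cong (λ x → K.sym (*-distribˡ-sum (χ x) (λ j → f j x))))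

  ∑ˣ-swap : ∀ (f : F.Carrier → F.Carrier → K.Carrier) → ∑ˣ (λ x → ∑ˣ (f x)) ≈ ∑ˣ (λ y → ∑ˣ (λ x → f x y))
  ∑ˣ-swap f = begin
    ∑ (λ x → χ x * ∑ (λ y → χ y * f x y))   ≈⟨ ∑-cong (λ x → K.sym (∑-*ˡ (χ x) _)) ⟩
    ∑ (λ x → ∑ (λ y → χ x * (χ y * f x y))) ≈⟨ ∑-swap (λ x y → χ x * (χ y * f x y)) ⟩
    ∑ (λ y → ∑ (λ x → χ x * (χ y * f x y))) ≈⟨ ∑-cong (λ y → ∑-cong (λ x → K′.solve 3 (λ a b d → a :* (b :* d) := b :* (a :* d)) K.refl (χ x) (χ y) (f x y))) ⟩
    ∑ (λ y → ∑ (λ x → χ y * (χ x * f x y))) ≈⟨ ∑-cong (λ y → ∑-*ˡ (χ y) _) ⟩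
    ∑ (λ y → χ y * ∑ (λ x → χ x * f x y))   ∎
    where open K′ using (_:=_; _:*_)

  ∑ˣ-sub : ∀ f g → ∑ˣ (λ x → f x - g x) ≈ ∑ˣ f - ∑ˣ g
  ∑ˣ-sub f g = begin
    ∑ (λ x → χ x * (f x - g x))                ≈⟨ ∑-cong (λ x → K′.solve 3 (λ c a b → c :* (a :- b) := c :* a :+ (:- :1) :* (c :* b)) K.refl (χ x) (f x) (g x)) ⟩
    ∑ (λ x → χ x * f x + (- 1#) * (χ x * g x)) ≈⟨ ∑-distrib _ _ ⟩
    ∑ˣ f + ∑ (λ x → (- 1#) * (χ x * g x))      ≈⟨ K.+-congˡ (∑-*ˡ (- 1#) _) ⟩
    ∑ˣ f + (- 1#) * ∑ˣ g                       ≈⟨ K′.solve 2 (λ a b → a :+ (:- :1) :* b := a :- b) K.refl (∑ˣ f) (∑ˣ g) ⟩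
    ∑ˣ f - ∑ˣ g                                ∎
    where open K′ using (_:=_; _:*_; _:+_; _:-_; :-_; :1)

  ∑ˣ-affine : ∀ f c d → ∑ˣ (λ x → f x * c - d) ≈ ∑ˣ f * c - K.fromℕ N * d
  ∑ˣ-affine f c d = K.trans (∑ˣ-sub (λ x → f x * c) (λ _ → d)) (K.+-cong (∑ˣ-*ʳ c f) (K.-‿cong (∑ˣ-const d)))

  ∑ˣ*∑ˣ : ∀ f g → ∑ˣ f * ∑ˣ g ≈ ∑ˣ (λ x → ∑ˣ (λ y → f x * g y))
  ∑ˣ*∑ˣ f g = K.trans (K.sym (∑ˣ-*ʳ (∑ˣ g) f)) (∑ˣ-cong (λ x _ → K.sym (∑ˣ-*ˡ (f x) g)))

  inv₀ : F.Carrier → F.Carrier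
  inv₀ x = if does (x F.≟ F.0#) then F.0# else F.inv x

  inv₀-≉0 : ∀ {x} → x F.≉ F.0# → inv₀ x F.≈ F.inv x
  inv₀-≉0 {x} x≉0 with x F.≟ F.0#
  ... | yes x≈0 = ⊥-elim (x≉0 x≈0)
  ... | no _    = F.refl

  inv₀≈0⇔≈0 : ∀ x → (inv₀ x F.≈ F.0# → x F.≈ F.0#) × (x F.≈ F.0# → inv₀ x F.≈ F.0#)
  inv₀≈0⇔≈0 x with x F.≟ F.0#
  ... | yes x≈0 = (λ _ → x≈0) , (λ _ → F.refl)
  ... | no x≉0  = (λ inv≈0 → ⊥-elim (F′.inv-nonzero x≉0 inv≈0)) , (λ x≈0 → ⊥-elim (x≉0 x≈0))

  inv₀-cong : ∀ {x y} → x F.≈ y → inv₀ x F.≈ inv₀ y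
  inv₀-cong {x} {y} x≈y with x F.≟ F.0# | y F.≟ F.0#
  ... | yes _   | yes _   = F.refl
  ... | no x≉0  | no _    = F′.inv-cong x≉0 x≈y
  ... | yes x≈0 | no y≉0  = ⊥-elim (y≉0 (F.trans (F.sym x≈y) x≈0))
  ... | no x≉0  | yes y≈0 = ⊥-elim (x≉0 (F.trans x≈y y≈0))

  inv₀-involutive : ∀ x → inv₀ (inv₀ x) F.≈ x
  inv₀-involutive x with x F.≟ F.0#
  ... | yes x≈0 = F.trans (proj₂ (inv₀≈0⇔≈0 F.0#) F.refl) (F.sym x≈0)
  ... | no x≉0  = F.trans (inv₀-≉0 (F′.inv-nonzero x≉0)) (F′.inv-involutive x≉0)

  ∑ˣ-inv : ∀ f → UnitCongruent f → ∑ˣ (λ x → f (F.inv x)) ≈ ∑ˣ f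
  ∑ˣ-inv f f-cong = begin
    ∑ (λ x → χ x * f (F.inv x))       ≈⟨ ∑-cong (λ x → K.trans (χ-guard (λ x≉0 → f-cong (F′.inv-nonzero x≉0) (F.sym (inv₀-≉0 x≉0))))
                                                                   (K.*-congʳ (χ-inv₀ x))) ⟩
    ∑ (λ x → χ (inv₀ x) * f (inv₀ x)) ≈⟨ ∑-reindex inv₀ inv₀ inv₀-cong inv₀-cong inv₀-involutive inv₀-involutive
                                                (λ x → χ x * f x) (χ*-cong f-cong) ⟩
    ∑ (λ x → χ x * f x)               ∎
    where
    χ-inv₀ : ∀ x → χ x ≈ χ (inv₀ x)
    χ-inv₀ x = []-cong (¬? (x F.≟ F.0#)) (¬? (inv₀ x F.≟ F.0#))
                 (λ x≉0 inv≈0 → x≉0 (proj₁ (inv₀≈0⇔≈0 x) inv≈0)) (λ inv≉0 x≈0 → inv≉0 (proj₂ (inv₀≈0⇔≈0 x) x≈0))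

  ∑ψ≈0 : ∑ ψ ≈ 0#
  ∑ψ≈0 = K′.c*x≈x⇒x≈0 ψa≉1 (begin
    ψ a * ∑ ψ             ≈⟨ K.sym (∑-*ˡ (ψ a) ψ) ⟩
    ∑ (λ x → ψ a * ψ x)   ≈⟨ ∑-cong (λ x → K.trans (K.*-comm _ _) (K.sym (ψ-hom x a))) ⟩
    ∑ (λ x → ψ (x F.+ a)) ≈⟨ ∑-translate a ψ ψ-cong ⟩
    ∑ ψ                   ∎)
    where
    a : F.Carrier
    a = proj₁ ψ-nontriv
    ψa≉1 : ψ a K.≉ 1#
    ψa≉1 = proj₂ ψ-nontriv

  ∑ψ-scaled : ∀ s → ∑ (λ x → ψ (x F.* s)) ≈ [ s F.≟ F.0# ] * K.fromℕ q
  ∑ψ-scaled s with s F.≟ F.0#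
  ... | yes s≈0 = begin
    ∑ (λ x → ψ (x F.* s)) ≈⟨ ∑-cong (λ x → K.trans (ψ-cong (F.trans (F.*-congˡ s≈0) (F.zeroʳ x))) ψ-0) ⟩
    ∑ (λ _ → 1#)          ≈⟨ ∑-const 1# ⟩
    K.fromℕ q * 1#        ≈⟨ K.*-comm _ _ ⟩
    1# * K.fromℕ q        ∎
  ... | no s≉0 = begin
    ∑ (λ x → ψ (x F.* s)) ≈⟨ ∑-cong (λ x → ψ-cong (F.*-comm x s)) ⟩
    ∑ (λ x → ψ (s F.* x)) ≈⟨ ∑-scale s≉0 ψ ψ-cong ⟩
    ∑ ψ                   ≈⟨ ∑ψ≈0 ⟩
    0#                    ≈⟨ K.sym (K.zeroˡ _) ⟩
    0# * K.fromℕ q        ∎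

  ∑ˣψ-scaled : ∀ s → ∑ˣ (λ x → ψ (x F.* s)) ≈ [ s F.≟ F.0# ] * K.fromℕ q - 1#
  ∑ˣψ-scaled s = begin
    ∑ˣ f                            ≈⟨ ∑ˣ≈∑-f0 f (λ x≈y → ψ-cong (F.*-congʳ x≈y)) ⟩
    ∑ f - f F.0#                    ≈⟨ K.+-cong (∑ψ-scaled s) (K.-‿cong f0≈1) ⟩
    [ s F.≟ F.0# ] * K.fromℕ q - 1# ∎
    where
    f : F.Carrier → K.Carrier
    f x = ψ (x F.* s)
    f0≈1 : f F.0# ≈ 1#
    f0≈1 = K.trans (ψ-cong (F.zeroˡ s)) ψ-0

  ω-nonzero : ∀ {x} → x F.≉ F.0# → ω x K.≉ 0#
  ω-nonzero {x} x≉0 ωx≈0 = K′.1≉0 (begin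
    1#                ≈⟨ K.sym ω-1 ⟩
    ω F.1#            ≈⟨ ω-cong (F.sym (F.inv-r x x≉0)) ⟩
    ω (x F.* F.inv x) ≈⟨ ω-hom x (F.inv x) x≉0 (F′.inv-nonzero x≉0) ⟩
    ω x * ω (F.inv x) ≈⟨ K.*-congʳ ωx≈0 ⟩
    0# * ω (F.inv x)  ≈⟨ K.zeroˡ _ ⟩
    0#                ∎)

  ω-inv : ∀ {x} → x F.≉ F.0# → K.inv (ω x) ≈ ω (F.inv x)
  ω-inv {x} x≉0 = K.sym (K′.inv-unique (ω-nonzero x≉0) (begin
    ω x * ω (F.inv x) ≈⟨ K.sym (ω-hom x (F.inv x) x≉0 (F′.inv-nonzero x≉0)) ⟩
    ω (x F.* F.inv x) ≈⟨ ω-cong (F.inv-r x x≉0) ⟩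
    ω F.1#            ≈⟨ ω-1 ⟩
    1#                ∎))

  ω-^ : ∀ {x} k → x F.≉ F.0# → ω x ^ k ≈ ω (x F.^ k)
  ω-^ zero    x≉0 = K.sym ω-1
  ω-^ {x} (suc k) x≉0 = K.trans (K.*-congˡ (ω-^ k x≉0)) (K.sym (ω-hom x _ x≉0 (F′.^-nonzero k x≉0)))

  prod-const : ∀ k c → Prod.sum {k} (λ _ → c) ≈ c ^ k
  prod-const zero    c = K.refl
  prod-const (suc k) c = K.*-congˡ (prod-const k c)

  prod-nonzero : ∀ {k} (v : Fin k → K.Carrier) → (∀ i → v i K.≉ 0#) → Prod.sum v K.≉ 0#
  prod-nonzero {zero}  v v≉0 = K′.1≉0
  prod-nonzero {suc k} v v≉0 = K′.*-nonzero (v≉0 Fin.zero) (prod-nonzero (v ∘ Fin.suc) (v≉0 ∘ Fin.suc))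

  ω^N≈1 : ∀ {a} → a F.≉ F.0# → ω a ^ N ≈ 1#
  ω^N≈1 {a} a≉0 = K′.*-cancelˡ P≉0 (begin
    P * ω a ^ N                                    ≈⟨ K.*-comm _ _ ⟩
    ω a ^ N * P                                    ≈⟨ K.*-congʳ (K.sym (K.trans (Π.∑-except-const F.0# (ω a)) (prod-const N (ω a)))) ⟩
    Π.∑ (Π.except F.0# (λ _ → ω a)) * P            ≈⟨ K.sym (Π.∑-distrib _ ωˣ) ⟩
    Π.∑ (λ y → Π.except F.0# (λ _ → ω a) y * ωˣ y) ≈⟨ Π.∑-cong ωa*ωy≈ωay ⟩
    Π.∑ (λ y → ωˣ (a F.* y))                       ≈⟨ Π.∑-scale a≉0 ωˣ (Π.except-cong F.0# ω ω-cong) ⟩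
    P                                              ≈⟨ K.sym (K.*-identityʳ P) ⟩
    P * 1#                                         ∎)
    where
    ωˣ : F.Carrier → K.Carrier
    ωˣ = Π.except F.0# ω
    P : K.Carrier
    P = Π.∑ ωˣ
    P≉0 : P K.≉ 0#
    P≉0 P≈0 = prod-nonzero (ωˣ ∘ F.enum) (λ i → ωˣ≉0 (F.enum i)) (K.trans (K.reflexive (≡.sym (Π.∑-def ωˣ))) P≈0)
      where
      ωˣ≉0 : ∀ y → ωˣ y K.≉ 0#
      ωˣ≉0 y with y F.≟ F.0#
      ... | yes _   = K′.1≉0
      ... | no y≉0 = ω-nonzero y≉0
    ωa*ωy≈ωay : ∀ y → Π.except F.0# (λ _ → ω a) y * ωˣ y ≈ ωˣ (a F.* y)
    ωa*ωy≈ωay y with y F.≟ F.0# | (a F.* y) F.≟ F.0#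
    ... | yes _   | yes _     = K.*-identityˡ 1#
    ... | yes y≈0 | no ay≉0   = ⊥-elim (ay≉0 (F.trans (F.*-congˡ y≈0) (F.zeroʳ a)))
    ... | no y≉0  | yes ay≈0  = ⊥-elim (F′.*-nonzero a≉0 y≉0 ay≈0)
    ... | no y≉0  | no _      = K.sym (ω-hom a y a≉0 y≉0)

  geom : K.Carrier → ℕ → K.Carrier
  geom z k = sum {k} (λ j → z ^ Fin.toℕ j)

  geom-telescope : ∀ z k → (z - 1#) * geom z k ≈ z ^ k - 1#
  geom-telescope z zero    = K.trans (K.zeroʳ _) (K.sym (K.-‿inverseʳ 1#))
  geom-telescope z (suc k) = begin
    (z - 1#) * (1# + sum {k} (λ j → z ^ Fin.toℕ (Fin.suc j))) ≈⟨ K.*-congˡ (K.+-congˡ (K.sym (*-distribˡ-sum {k} z (λ j → z ^ Fin.toℕ j)))) ⟩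
    (z - 1#) * (1# + z * geom z k)                            ≈⟨ K′.solve 2 (λ y g → (y :- :1) :* (:1 :+ y :* g) := (y :- :1) :+ y :* ((y :- :1) :* g)) K.refl z (geom z k) ⟩
    (z - 1#) + z * ((z - 1#) * geom z k)                      ≈⟨ K.+-congˡ (K.*-congˡ (geom-telescope z k)) ⟩
    (z - 1#) + z * (z ^ k - 1#)                               ≈⟨ K′.solve 2 (λ y p → (y :- :1) :+ y :* (p :- :1) := y :* p :- :1) K.refl z (z ^ k) ⟩
    z * z ^ k - 1#                                            ∎
    where
    open K′ using (_:=_; _:+_; _:-_; _:*_; :1)

  geom-1 : ∀ {z} k → z ≈ 1# → geom z k ≈ K.fromℕ k
  geom-1 {z} k z≈1 = begin
    sum {k} (λ j → z ^ Fin.toℕ j) ≈⟨ sum-cong-≋ {k} (λ j → K.trans (K′.^-cong (Fin.toℕ j) z≈1) (K′.1^n≈1 (Fin.toℕ j))) ⟩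
    sum {k} (λ _ → 1#)            ≈⟨ sum-const k 1# ⟩
    K.fromℕ k * 1#                ≈⟨ K.*-identityʳ _ ⟩
    K.fromℕ k                     ∎

  ω-fixes-geom : ∀ {b} → b F.≉ F.0# → ω b * geom (ω b) N ≈ geom (ω b) N
  ω-fixes-geom {b} b≉0 = begin
    ω b * S            ≈⟨ K′.solve 2 (λ z s → z :* s := (z :- :1) :* s :+ s) K.refl (ω b) S ⟩
    (ω b - 1#) * S + S ≈⟨ K.+-congʳ (geom-telescope (ω b) N) ⟩
    (ω b ^ N - 1#) + S ≈⟨ K.+-congʳ (K.+-congʳ (ω^N≈1 b≉0)) ⟩
    (1# - 1#) + S      ≈⟨ K.trans (K.+-congʳ (K.-‿inverseʳ 1#)) (K.+-identityˡ S) ⟩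
    S                  ∎
    where
    open K′ using (_:=_; _:+_; _:-_; _:*_; :1)
    S = geom (ω b) N

  ω^k-fixes-geom : ∀ {b} → b F.≉ F.0# → ∀ k → ω b ^ k * geom (ω b) N ≈ geom (ω b) N
  ω^k-fixes-geom b≉0 zero    = K.*-identityˡ _
  ω^k-fixes-geom b≉0 (suc k) = K.trans (K.*-assoc _ _ _) (K.trans (K.*-congˡ (ω^k-fixes-geom b≉0 k)) (ω-fixes-geom b≉0))

  geom²≈N*geom : ∀ {b} → b F.≉ F.0# → geom (ω b) N * geom (ω b) N ≈ K.fromℕ N * geom (ω b) N
  geom²≈N*geom {b} b≉0 = begin
    S * S                               ≈⟨ *-distribʳ-sum {N} S (λ j → ω b ^ Fin.toℕ j) ⟩
    sum {N} (λ j → ω b ^ Fin.toℕ j * S) ≈⟨ sum-cong-≋ {N} (λ j → ω^k-fixes-geom b≉0 (Fin.toℕ j)) ⟩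
    sum {N} (λ _ → S)                   ≈⟨ sum-const N S ⟩
    K.fromℕ N * S                       ∎
    where S = geom (ω b) N

  ∑ˣω^k≈0 : ∀ k → 0 ℕ.< k → k ℕ.< N → ∑ˣ (λ x → ω x ^ k) ≈ 0#
  ∑ˣω^k≈0 k 0<k k<N = K′.c*x≈x⇒x≈0 c≉1 (begin
    c * ∑ˣ f               ≈⟨ K.sym (∑ˣ-*ˡ c f) ⟩
    ∑ˣ (λ x → c * f x)     ≈⟨ ∑ˣ-cong c*fx≈f[ax] ⟩
    ∑ˣ (λ x → f (a F.* x)) ≈⟨ ∑ˣ-scale a≉0 f (λ _ x≈y → K′.^-cong k (ω-cong x≈y)) ⟩
    ∑ˣ f                   ∎)
    where
    f : F.Carrier → K.Carrier
    f x = ω x ^ k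
    a : F.Carrier
    a = proj₁ (ω-gen k 0<k k<N)
    a≉0 : a F.≉ F.0#
    a≉0 = proj₁ (proj₂ (ω-gen k 0<k k<N))
    c : K.Carrier
    c = ω a ^ k
    c≉1 : c K.≉ 1#
    c≉1 = proj₂ (proj₂ (ω-gen k 0<k k<N))
    c*fx≈f[ax] : ∀ x → x F.≉ F.0# → c * f x ≈ f (a F.* x)
    c*fx≈f[ax] x x≉0 = K.trans (K.sym (K′.^-distribʳ-* (ω a) (ω x) k)) (K′.^-cong k (K.sym (ω-hom a x a≉0 x≉0)))

  ∑ˣgeom≈N : ∑ˣ (λ x → geom (ω x) N) ≈ K.fromℕ N
  ∑ˣgeom≈N = begin
    ∑ (λ x → χ x * sum {N} (λ j → ω x ^ Fin.toℕ j))   ≈⟨ ∑-cong (λ x → *-distribˡ-sum {N} (χ x) (λ j → ω x ^ Fin.toℕ j)) ⟩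
    ∑ (λ x → sum {N} (λ j → χ x * ω x ^ Fin.toℕ j))   ≈⟨ K.sym (sum-∑-swap {N} (λ j x → χ x * ω x ^ Fin.toℕ j)) ⟩
    ∑ˣ (λ _ → 1#) + sum {n} (λ j → ∑ˣ (λ x → ω x ^ suc (Fin.toℕ j)))
        ≈⟨ K.+-cong (K.trans (∑ˣ-const 1#) (K.*-identityʳ _)) (K.trans (sum-cong-≋ {n} nontrivial≈0) (K.trans (sum-const n 0#) (K.zeroʳ _))) ⟩
    K.fromℕ N + 0#                                    ≈⟨ K.+-identityʳ _ ⟩
    K.fromℕ N                                         ∎
    where
    nontrivial≈0 : ∀ j → ∑ˣ (λ x → ω x ^ suc (Fin.toℕ j)) ≈ 0#
    nontrivial≈0 j = ∑ˣω^k≈0 (suc (Fin.toℕ j)) (ℕ.s≤s ℕ.z≤n) (ℕ.s≤s (toℕ<n j))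

  [χ*geom]²≈N*[χ*geom] : ∀ x → (χ x * geom (ω x) N) * (χ x * geom (ω x) N) ≈ K.fromℕ N * (χ x * geom (ω x) N)
  [χ*geom]²≈N*[χ*geom] x = begin
    (χ x * S) * (χ x * S) ≈⟨ K′.solve 2 (λ c y → (c :* y) :* (c :* y) := (c :* c) :* (y :* y)) K.refl (χ x) S ⟩
    (χ x * χ x) * (S * S) ≈⟨ K.trans (K.*-congʳ (χ²≈χ x)) (χ-guard geom²≈N*geom) ⟩
    χ x * (K.fromℕ N * S) ≈⟨ K′.solve 3 (λ c m y → c :* (m :* y) := m :* (c :* y)) K.refl (χ x) (K.fromℕ N) S ⟩
    K.fromℕ N * (χ x * S) ∎
    where
    open K′ using (_:=_; _:*_)
    S : K.Carrier
    S = geom (ω x) N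

  -- For x ≠ 0, S x = Σ_{j<N} ω(x)^j satisfies S² = N S, S 1 = N and Σ_{x≠0} S x = N.
  -- A unit b ≠ 1 with ω b = 1 would leave the remaining terms, each with v² = N v,
  -- summing to -N, which sum+[1+r]*c≉0 excludes.
  ω-injective : ∀ {b} → b F.≉ F.0# → ω b ≈ 1# → b F.≈ F.1#
  ω-injective {b} b≉0 ωb≈1 with b F.≟ F.1#
  ... | yes b≈1 = b≈1
  ... | no b≉1 = ⊥-elim (sum+[1+r]*c≉0 N≉0 (R ∘ F.enum) (λ i → R² (F.enum i)) 0 (begin
    sum (R ∘ F.enum) + (1# + 0#) * K.fromℕ N    ≈⟨ K.+-cong (K.reflexive (≡.sym (∑-def R))) (K.*-congʳ (K.+-identityʳ 1#)) ⟩
    ∑ R + 1# * K.fromℕ N                        ≈⟨ K.+-congˡ (K.*-identityˡ _) ⟩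
    ∑ R + K.fromℕ N                             ≈⟨ K′.solve 2 (λ r m → r :+ m := (m :+ (m :+ r)) :- m) K.refl (∑ R) (K.fromℕ N) ⟩
    (K.fromℕ N + (K.fromℕ N + ∑ R)) - K.fromℕ N ≈⟨ K.+-congʳ (K.sym ∑T≈N+[N+∑R]) ⟩
    ∑ T - K.fromℕ N                             ≈⟨ K.+-congʳ ∑ˣgeom≈N ⟩
    K.fromℕ N - K.fromℕ N                       ≈⟨ K.-‿inverseʳ _ ⟩
    0#                                          ∎))
    where
    open K′ using (_:=_; _:+_; _:-_)
    N≉0 : K.fromℕ N K.≉ 0#
    N≉0 = K.char0 n
    S T R : F.Carrier → K.Carrier
    S x = geom (ω x) N
    T x = χ x * S x
    R = except b (except F.1# T)
    T-cong : Congruent T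
    T-cong x≈y = K.*-cong (χ-cong x≈y) (sum-cong-≋ {N} (λ j → K′.^-cong (Fin.toℕ j) (ω-cong x≈y)))
    R² : ∀ x → R x * R x ≈ K.fromℕ N * R x
    R² x with x F.≟ b | x F.≟ F.1#
    ... | yes _ | _     = K.trans (K.zeroˡ _) (K.sym (K.zeroʳ _))
    ... | no _  | yes _ = K.trans (K.zeroˡ _) (K.sym (K.zeroʳ _))
    ... | no _  | no _  = [χ*geom]²≈N*[χ*geom] x
    T≈N : ∀ {x} → x F.≉ F.0# → ω x ≈ 1# → T x ≈ K.fromℕ N
    T≈N x≉0 ωx≈1 = K.trans (K.*-congʳ (χ-≉0 x≉0)) (K.trans (K.*-identityˡ _) (geom-1 N ωx≈1))
    ∑T≈N+[N+∑R] : ∑ T ≈ K.fromℕ N + (K.fromℕ N + ∑ R)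
    ∑T≈N+[N+∑R] = begin
      ∑ T                                 ≈⟨ ∑-remove F.1# T T-cong ⟩
      T F.1# + ∑ (except F.1# T)          ≈⟨ K.+-cong (T≈N F′.1≉0 ω-1) (∑-remove b (except F.1# T) (except-cong F.1# T T-cong)) ⟩
      K.fromℕ N + (except F.1# T b + ∑ R) ≈⟨ K.+-congˡ (K.+-congʳ (K.trans (except-≉ {F.1#} {T} b≉1) (T≈N b≉0 ωb≈1))) ⟩
      K.fromℕ N + (K.fromℕ N + ∑ R)       ∎

  orthogonality : ∀ {b} → b F.≉ F.0# → geom (ω b) N ≈ [ b F.≟ F.1# ] * K.fromℕ N
  orthogonality {b} b≉0 with b F.≟ F.1#
  ... | yes b≈1 = K.trans (geom-1 N (K.trans (ω-cong b≈1) ω-1)) (K.sym (K.*-identityˡ _))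
  ... | no b≉1 = K.trans (K′.c*x≈x⇒x≈0 (λ ωb≈1 → b≉1 (ω-injective b≉0 ωb≈1)) (ω-fixes-geom b≉0))
                         (K.sym (K.zeroˡ _))

  sumL-map-filter : ∀ f xs → K.sumL (map f (filter (λ x → ¬? (x F.≟ F.0#)) xs)) ≈ K.sumL (map (λ x → χ x * f x) xs)
  sumL-map-filter f []       = K.refl
  sumL-map-filter f (x ∷ xs) with x F.≟ F.0#
  ... | yes _ = K.trans (sumL-map-filter f xs) (K.sym (K.trans (K.+-congʳ (K.zeroˡ _)) (K.+-identityˡ _)))
  ... | no _  = K.+-cong (K.sym (K.*-identityˡ _)) (sumL-map-filter f xs)

  sumL-map-tabulate : ∀ {k} (h : F.Carrier → K.Carrier) (e : Fin k → F.Carrier) → K.sumL (map h (tabulate e)) ≡ sum (h ∘ e)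
  sumL-map-tabulate {zero}  h e = ≡.refl
  sumL-map-tabulate {suc k} h e = ≡.cong (h (e Fin.zero) K.+_) (sumL-map-tabulate h (e ∘ Fin.suc))

  sumL-elements : ∀ h → K.sumL (map h F.elements) ≈ ∑ h
  sumL-elements h = K.reflexive (≡.trans (sumL-map-tabulate h F.enum) (≡.sym (∑-def h)))

  sumL-units : ∀ f → K.sumL (map f F.units) ≈ ∑ˣ f
  sumL-units f = K.trans (sumL-map-filter f F.elements) (sumL-elements _)

  gauss-∑ˣ : ∀ k → gauss F K ψc ωc k ≈ ∑ˣ (λ x → (ω x K.^ᶻ k) * ψ x)
  gauss-∑ˣ k = sumL-units _

  gauss-0 : gauss F K ψc ωc (+ 0) ≈ - 1#
  gauss-0 = begin
    gauss F K ψc ωc (+ 0) ≈⟨ gauss-∑ˣ (+ 0) ⟩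
    ∑ˣ (λ x → 1# * ψ x)   ≈⟨ ∑ˣ-cong (λ x _ → K.*-identityˡ _) ⟩
    ∑ˣ ψ                  ≈⟨ ∑ˣ≈∑-f0 ψ ψ-cong ⟩
    ∑ ψ - ψ F.0#          ≈⟨ K.+-cong ∑ψ≈0 (K.-‿cong ψ-0) ⟩
    0# - 1#               ≈⟨ K.+-identityˡ _ ⟩
    - 1#                  ∎

  gauss-3m : ∀ m → gauss F K ψc ωc (+ (3 ℕ.* m)) ≈ ∑ˣ (λ x → ω (x F.^ 3) ^ m * ψ x)
  gauss-3m m = K.trans (gauss-∑ˣ (+ (3 ℕ.* m))) (∑ˣ-cong (λ x x≉0 →
                 K.*-congʳ (K.trans (K′.^-assoc (ω x) 3 m) (K′.^-cong m (ω-^ 3 x≉0)))))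

  gauss-neg : ∀ m → gauss F K ψc ωc (ℤ.- (+ m)) ≈ ∑ˣ (λ y → ω (F.inv y) ^ m * ψ y)
  gauss-neg m = K.trans (gauss-∑ˣ (ℤ.- (+ m))) (∑ˣ-cong (λ y y≉0 → K.*-congʳ (ω^ᶻ-neg m y≉0)))
    where
    ω^ᶻ-neg : ∀ m {y} → y F.≉ F.0# → ω y K.^ᶻ (ℤ.- (+ m)) ≈ ω (F.inv y) ^ m
    ω^ᶻ-neg zero    y≉0 = K.refl
    ω^ᶻ-neg (suc k) y≉0 = K′.^-cong (suc k) (ω-inv y≉0)

  sumL-map-applyUpTo : ∀ (f : ℕ → K.Carrier) (g : ℕ → ℕ) k → K.sumL (map f (applyUpTo g k)) ≡ sum {k} (λ j → f (g (Fin.toℕ j)))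
  sumL-map-applyUpTo f g zero    = ≡.refl
  sumL-map-applyUpTo f g (suc k) = ≡.cong (f (g 0) K.+_) (sumL-map-applyUpTo f (g ∘ suc) k)

  fromℕ-length-filter : ∀ {A : Set} {P : A → Set} (P? : ∀ a → Dec (P a)) xs →
                        K.fromℕ (length (filter P? xs)) ≈ K.sumL (map (λ a → [ P? a ]) xs)
  fromℕ-length-filter P? []       = K.refl
  fromℕ-length-filter P? (x ∷ xs) with P? x
  ... | yes _ = K.+-congˡ (fromℕ-length-filter P? xs)
  ... | no _  = K.trans (fromℕ-length-filter P? xs) (K.sym (K.+-identityˡ _))

  sumL-++ : ∀ xs ys → K.sumL (xs ++ ys) ≈ K.sumL xs + K.sumL ys
  sumL-++ []       ys = K.sym (K.+-identityˡ _)
  sumL-++ (x ∷ xs) ys = K.trans (K.+-congˡ (sumL-++ xs ys)) (K.sym (K.+-assoc _ _ _))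

  sumL-cartesianProduct : ∀ {A B : Set} (g : A × B → K.Carrier) xs ys →
    K.sumL (map g (cartesianProduct xs ys)) ≈ K.sumL (map (λ x → K.sumL (map (λ y → g (x , y)) ys)) xs)
  sumL-cartesianProduct g []       ys = K.refl
  sumL-cartesianProduct g (x ∷ xs) ys = begin
    K.sumL (map g (map (x ,_) ys ++ cartesianProduct xs ys))            ≡⟨ ≡.cong K.sumL (map-++ g (map (x ,_) ys) _) ⟩
    K.sumL (map g (map (x ,_) ys) ++ map g (cartesianProduct xs ys))    ≈⟨ sumL-++ (map g (map (x ,_) ys)) _ ⟩
    K.sumL (map g (map (x ,_) ys)) + K.sumL (map g (cartesianProduct xs ys))
      ≈⟨ K.+-cong (K.reflexive (≡.cong K.sumL (≡.sym (map-∘ ys)))) (sumL-cartesianProduct g xs ys) ⟩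
    K.sumL (map (λ y → g (x , y)) ys) + K.sumL (map (λ x → K.sumL (map (λ y → g (x , y)) ys)) xs) ∎

module CurvePointCount (n : ℕ) (F : FiniteField (suc (suc n))) (K : Char0Field)
                       (ψc : AddChar F K) (ωc : MulCharGen F K) where
  open CharacterSums n F K ψc ωc
  open AddChar ψc
  open MulCharGen ωc
  open FiniteSums F K.+-commutativeMonoid
  open import Algebra.Properties.Semiring.Sum K.semiring using (sum; sum-cong-≋; *-distribˡ-sum)
  open K using (_≈_; _+_; _*_; -_; _-_; 0#; 1#; _^_)
  open import Relation.Binary.Reasoning.Setoid K.setoid

  module _ (lam : F.Carrier) (lam≉0 : lam F.≉ F.0#) (3≉0 : F.fromℕ 3 F.≉ F.0#) where
    -- ε M⁻¹ t of the definition of H, with ε = -1, M = 27 and t = 27λ.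
    arg : F.Carrier
    arg = (F.- F.1#) F.* F.inv (F.fromℕ 27) F.* (F.fromℕ 27 F.* lam)

    arg≈-lam : arg F.≈ F.- lam
    arg≈-lam =
      F.trans (F′.solve 4 (λ m i t l → (m :* i) :* (t :* l) := m :* ((i :* t) :* l)) F.refl (F.- F.1#) (F.inv 27′) 27′ lam)
      (F.trans (F.*-congˡ (F.*-congʳ (F′.inv-l 27′ 27≉0)))
               (F′.solve 1 (λ l → (:- :1) :* (:1 :* l) := :- l) F.refl lam))
      where
      open F′ using (_:=_; _:*_; :-_; :1)
      27′ : F.Carrier
      27′ = F.fromℕ 27
      27≉0 : 27′ F.≉ F.0#
      27≉0 27≈0 = F′.*-nonzero 3≉0 (F′.*-nonzero 3≉0 3≉0)
                    (F.trans (F.sym (F.trans (F′.fromℕ-homo-* 3 9) (F.*-congˡ (F′.fromℕ-homo-* 3 3)))) 27≈0)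

    arg≉0 : arg F.≉ F.0#
    arg≉0 arg≈0 = lam≉0 (F.trans (F.sym (F′.-‿involutive lam))
                     (F.trans (F.-‿cong (F.trans (F.sym arg≈-lam) arg≈0)) F′.-0#≈0#))

    W : ℕ → K.Carrier
    W m = (gauss F K ψc ωc (+ (3 ℕ.* m)) * gauss F K ψc ωc (ℤ.- (+ m)) ^ 3) * ω arg ^ m

    v : F.Carrier → F.Carrier → F.Carrier → F.Carrier
    v x y z = x F.^ 3 F.* (F.inv y F.* (F.inv z F.* arg))

    β : F.Carrier → F.Carrier → F.Carrier → F.Carrier → F.Carrier
    β x y z w = x F.^ 3 F.* (F.inv y F.* (F.inv z F.* (F.inv w F.* arg)))

    ∑ˣ⁴ : (F.Carrier → F.Carrier → F.Carrier → F.Carrier → K.Carrier) → K.Carrier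
    ∑ˣ⁴ f = ∑ˣ λ x → ∑ˣ λ y → ∑ˣ λ z → ∑ˣ λ w → f x y z w

    ∑ˣ⁴-cong : ∀ {f g} → (∀ {x y z w} → x F.≉ F.0# → y F.≉ F.0# → z F.≉ F.0# → w F.≉ F.0# → f x y z w ≈ g x y z w) →
               ∑ˣ⁴ f ≈ ∑ˣ⁴ g
    ∑ˣ⁴-cong f≈g = ∑ˣ-cong λ _ x≉0 → ∑ˣ-cong λ _ y≉0 → ∑ˣ-cong λ _ z≉0 → ∑ˣ-cong λ _ w≉0 → f≈g x≉0 y≉0 z≉0 w≉0

    sum-∑ˣ⁴-swap : ∀ {k} (f : Fin k → F.Carrier → F.Carrier → F.Carrier → F.Carrier → K.Carrier) →
                   sum (λ j → ∑ˣ⁴ (f j)) ≈ ∑ˣ⁴ (λ x y z w → sum (λ j → f j x y z w))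
    sum-∑ˣ⁴-swap {k} f =
      K.trans (sum-∑ˣ-swap {k} (λ j x → ∑ˣ λ y → ∑ˣ λ z → ∑ˣ λ w → f j x y z w)) (∑ˣ-cong λ x _ →
      K.trans (sum-∑ˣ-swap {k} (λ j y → ∑ˣ λ z → ∑ˣ λ w → f j x y z w)) (∑ˣ-cong λ y _ →
      K.trans (sum-∑ˣ-swap {k} (λ j z → ∑ˣ λ w → f j x y z w)) (∑ˣ-cong λ z _ →
      sum-∑ˣ-swap {k} (λ j w → f j x y z w))))

    summand : ℕ → F.Carrier → F.Carrier → F.Carrier → F.Carrier → K.Carrier
    summand m x y z w = (ω (x F.^ 3) ^ m * ψ x) * ((ω (F.inv y) ^ m * ψ y) * ((ω (F.inv z) ^ m * ψ z) * ((ω (F.inv w) ^ m * ψ w) * ω arg ^ m)))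

    W≈∑ˣ⁴summand : ∀ m → W m ≈ ∑ˣ⁴ (summand m)
    W≈∑ˣ⁴summand m = begin
      W m                                                   ≈⟨ K.*-congʳ (K.*-cong (gauss-3m m) (K′.^-cong 3 (gauss-neg m))) ⟩
      (∑ˣ a * (∑ˣ b * (∑ˣ b * (∑ˣ b * 1#)))) * e            ≈⟨ K′.solve 3 (λ p r s → (p :* (r :* (r :* (r :* :1)))) :* s := p :* (r :* (r :* (r :* s)))) K.refl (∑ˣ a) (∑ˣ b) e ⟩
      ∑ˣ a * (∑ˣ b * (∑ˣ b * (∑ˣ b * e)))                   ≈⟨ K.*-congˡ (K.*-congˡ (K.*-congˡ (K.sym (∑ˣ-*ʳ e b)))) ⟩
      ∑ˣ a * (∑ˣ b * (∑ˣ b * ∑ˣ (λ w → b w * e)))           ≈⟨ K.*-congˡ (K.*-congˡ (∑ˣ*∑ˣ b _)) ⟩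
      ∑ˣ a * (∑ˣ b * ∑ˣ (λ z → ∑ˣ (λ w → b z * (b w * e)))) ≈⟨ K.*-congˡ (K.trans (∑ˣ*∑ˣ b _) (∑ˣ-cong λ y _ → ∑ˣ-cong λ z _ → K.sym (∑ˣ-*ˡ (b y) _))) ⟩
      ∑ˣ a * ∑ˣ (λ y → ∑ˣ (λ z → ∑ˣ (λ w → b y * (b z * (b w * e))))) ≈⟨ K.trans (∑ˣ*∑ˣ a _) (∑ˣ-cong λ x _ → ∑ˣ-cong λ y _ →
                                                                           K.trans (K.sym (∑ˣ-*ˡ (a x) _)) (∑ˣ-cong λ z _ → K.sym (∑ˣ-*ˡ (a x) _))) ⟩
      ∑ˣ⁴ (summand m)                                       ∎
      where
      open K′ using (_:=_; _:*_; :1)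
      a b : F.Carrier → K.Carrier
      a x = ω (x F.^ 3) ^ m * ψ x
      b y = ω (F.inv y) ^ m * ψ y
      e : K.Carrier
      e = ω arg ^ m

    summand≈ : ∀ m {x y z w} → x F.≉ F.0# → y F.≉ F.0# → z F.≉ F.0# → w F.≉ F.0# →
               summand m x y z w ≈ ψ (x F.+ y F.+ z F.+ w) * ω (β x y z w) ^ m
    summand≈ m {x} {y} {z} {w} x≉0 y≉0 z≉0 w≉0 = begin
      (ωx³ ^ m * ψ x) * ((ωy⁻¹ ^ m * ψ y) * ((ωz⁻¹ ^ m * ψ z) * ((ωw⁻¹ ^ m * ψ w) * ωarg ^ m)))
        ≈⟨ K′.solve 9 (λ a b c d e px py pz pw →
             (a :* px) :* ((b :* py) :* ((c :* pz) :* ((d :* pw) :* e))) :=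
             (((px :* py) :* pz) :* pw) :* (a :* (b :* (c :* (d :* e)))))
             K.refl (ωx³ ^ m) (ωy⁻¹ ^ m) (ωz⁻¹ ^ m) (ωw⁻¹ ^ m) (ωarg ^ m) (ψ x) (ψ y) (ψ z) (ψ w) ⟩
      (((ψ x * ψ y) * ψ z) * ψ w) * (ωx³ ^ m * (ωy⁻¹ ^ m * (ωz⁻¹ ^ m * (ωw⁻¹ ^ m * ωarg ^ m))))
        ≈⟨ K.*-cong ψ-hom⁴ (K.sym (^-distrib⁵ ωx³ ωy⁻¹ ωz⁻¹ ωw⁻¹ ωarg)) ⟩
      ψ (x F.+ y F.+ z F.+ w) * (ωx³ * (ωy⁻¹ * (ωz⁻¹ * (ωw⁻¹ * ωarg)))) ^ m
        ≈⟨ K.*-congˡ (K′.^-cong m ω-hom⁵) ⟩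
      ψ (x F.+ y F.+ z F.+ w) * ω (β x y z w) ^ m ∎
      where
      open K′ using (_:=_; _:*_)
      ωx³ ωy⁻¹ ωz⁻¹ ωw⁻¹ ωarg : K.Carrier
      ωx³ = ω (x F.^ 3)
      ωy⁻¹ = ω (F.inv y)
      ωz⁻¹ = ω (F.inv z)
      ωw⁻¹ = ω (F.inv w)
      ωarg = ω arg
      ψ-hom⁴ : ((ψ x * ψ y) * ψ z) * ψ w ≈ ψ (x F.+ y F.+ z F.+ w)
      ψ-hom⁴ = K.sym (K.trans (ψ-hom _ w) (K.*-congʳ (K.trans (ψ-hom _ z) (K.*-congʳ (ψ-hom x y)))))
      ^-distrib⁵ : ∀ a b c d e → (a * (b * (c * (d * e)))) ^ m ≈ a ^ m * (b ^ m * (c ^ m * (d ^ m * e ^ m)))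
      ^-distrib⁵ a b c d e = K.trans (K′.^-distribʳ-* a _ m) (K.*-congˡ (K.trans (K′.^-distribʳ-* b _ m)
                               (K.*-congˡ (K.trans (K′.^-distribʳ-* c _ m) (K.*-congˡ (K′.^-distribʳ-* d e m))))))
      iy≉0 : F.inv y F.≉ F.0#
      iy≉0 = F′.inv-nonzero y≉0
      iz≉0 : F.inv z F.≉ F.0#
      iz≉0 = F′.inv-nonzero z≉0
      iw≉0 : F.inv w F.≉ F.0#
      iw≉0 = F′.inv-nonzero w≉0
      ω-hom⁵ : ωx³ * (ωy⁻¹ * (ωz⁻¹ * (ωw⁻¹ * ωarg))) ≈ ω (β x y z w)
      ω-hom⁵ = K.sym (
        K.trans (ω-hom _ _ (F′.^-nonzero 3 x≉0) (F′.*-nonzero iy≉0 (F′.*-nonzero iz≉0 (F′.*-nonzero iw≉0 arg≉0))))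
        (K.*-congˡ (K.trans (ω-hom _ _ iy≉0 (F′.*-nonzero iz≉0 (F′.*-nonzero iw≉0 arg≉0)))
        (K.*-congˡ (K.trans (ω-hom _ _ iz≉0 (F′.*-nonzero iw≉0 arg≉0))
        (K.*-congˡ (ω-hom _ _ iw≉0 arg≉0)))))))

    β-nonzero : ∀ {x y z w} → x F.≉ F.0# → y F.≉ F.0# → z F.≉ F.0# → w F.≉ F.0# → β x y z w F.≉ F.0#
    β-nonzero x≉0 y≉0 z≉0 w≉0 = F′.*-nonzero (F′.^-nonzero 3 x≉0) (F′.*-nonzero (F′.inv-nonzero y≉0)
                                  (F′.*-nonzero (F′.inv-nonzero z≉0) (F′.*-nonzero (F′.inv-nonzero w≉0) arg≉0)))

    v-nonzero : ∀ {x y z} → x F.≉ F.0# → y F.≉ F.0# → z F.≉ F.0# → v x y z F.≉ F.0#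
    v-nonzero x≉0 y≉0 z≉0 = F′.*-nonzero (F′.^-nonzero 3 x≉0) (F′.*-nonzero (F′.inv-nonzero y≉0)
                              (F′.*-nonzero (F′.inv-nonzero z≉0) arg≉0))

    β≈1⇔w≈v : ∀ {x y z w} → w F.≉ F.0# → (β x y z w F.≈ F.1# → w F.≈ v x y z) × (w F.≈ v x y z → β x y z w F.≈ F.1#)
    β≈1⇔w≈v {x} {y} {z} {w} w≉0 =
      (λ β≈1 → F.sym (F.trans (F′.inv-unique (F′.inv-nonzero w≉0) (F.trans (F.sym β≈w⁻¹v) β≈1)) (F′.inv-involutive w≉0))) ,
      (λ w≈v → F.trans β≈w⁻¹v (F.trans (F.*-congˡ (F.sym w≈v)) (F′.inv-l w w≉0)))
      where
      open F′ using (_:=_; _:*_)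
      β≈w⁻¹v : β x y z w F.≈ F.inv w F.* v x y z
      β≈w⁻¹v = F′.solve 5 (λ X a b c d → X :* (a :* (b :* (c :* d))) := c :* (X :* (a :* (b :* d))))
                 F.refl (x F.^ 3) (F.inv y) (F.inv z) (F.inv w) arg

    ∑summand≈ : ∀ {x y z w} → x F.≉ F.0# → y F.≉ F.0# → z F.≉ F.0# → w F.≉ F.0# →
                sum {N} (λ j → summand (Fin.toℕ j) x y z w) ≈ [ w F.≟ v x y z ] * (ψ (x F.+ y F.+ z F.+ w) * K.fromℕ N)
    ∑summand≈ {x} {y} {z} {w} x≉0 y≉0 z≉0 w≉0 = begin
      sum {N} (λ j → summand (Fin.toℕ j) x y z w)         ≈⟨ sum-cong-≋ {N} (λ j → summand≈ (Fin.toℕ j) x≉0 y≉0 z≉0 w≉0) ⟩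
      sum {N} (λ j → ψ Σxyzw * ω (β x y z w) ^ Fin.toℕ j) ≈⟨ K.sym (*-distribˡ-sum {N} (ψ Σxyzw) (λ j → ω (β x y z w) ^ Fin.toℕ j)) ⟩
      ψ Σxyzw * geom (ω (β x y z w)) N                    ≈⟨ K.*-congˡ (orthogonality (β-nonzero x≉0 y≉0 z≉0 w≉0)) ⟩
      ψ Σxyzw * ([ β x y z w F.≟ F.1# ] * K.fromℕ N)      ≈⟨ K.*-congˡ (K.*-congʳ ([]-cong (_ F.≟ F.1#) (w F.≟ v x y z) (proj₁ (β≈1⇔w≈v w≉0)) (proj₂ (β≈1⇔w≈v w≉0)))) ⟩
      ψ Σxyzw * ([ w F.≟ v x y z ] * K.fromℕ N)           ≈⟨ K′.solve 3 (λ p i n → p :* (i :* n) := i :* (p :* n)) K.refl (ψ Σxyzw) _ (K.fromℕ N) ⟩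
      [ w F.≟ v x y z ] * (ψ Σxyzw * K.fromℕ N)           ∎
      where
      open K′ using (_:=_; _:*_)
      Σxyzw : F.Carrier
      Σxyzw = x F.+ y F.+ z F.+ w

    V : K.Carrier
    V = ∑ˣ λ x → ∑ˣ λ y → ∑ˣ λ z → ψ (x F.+ y F.+ z F.+ v x y z)

    ∑W≈V*N : sum {N} (λ j → W (Fin.toℕ j)) ≈ V * K.fromℕ N
    ∑W≈V*N = begin
      sum {N} (λ j → W (Fin.toℕ j))                           ≈⟨ sum-cong-≋ {N} (λ j → W≈∑ˣ⁴summand (Fin.toℕ j)) ⟩
      sum {N} (λ j → ∑ˣ⁴ (summand (Fin.toℕ j)))               ≈⟨ sum-∑ˣ⁴-swap {N} (λ j → summand (Fin.toℕ j)) ⟩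
      ∑ˣ⁴ (λ x y z w → sum {N} (λ j → summand (Fin.toℕ j) x y z w)) ≈⟨ ∑ˣ⁴-cong ∑summand≈ ⟩
      ∑ˣ⁴ (λ x y z w → [ w F.≟ v x y z ] * (ψ (x F.+ y F.+ z F.+ w) * K.fromℕ N))
        ≈⟨ (∑ˣ-cong λ x x≉0 → ∑ˣ-cong λ y y≉0 → ∑ˣ-cong λ z z≉0 →
             ∑ˣ-δ (v-nonzero x≉0 y≉0 z≉0) (λ w → ψ (x F.+ y F.+ z F.+ w) * K.fromℕ N) (λ w≈w′ → K.*-congʳ (ψ-cong (F.+-congˡ w≈w′)))) ⟩
      (∑ˣ λ x → ∑ˣ λ y → ∑ˣ λ z → ψ (x F.+ y F.+ z F.+ v x y z) * K.fromℕ N)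
        ≈⟨ K.trans (∑ˣ-cong λ x _ → K.trans (∑ˣ-cong λ y _ → ∑ˣ-*ʳ (K.fromℕ N) _) (∑ˣ-*ʳ (K.fromℕ N) _)) (∑ˣ-*ʳ (K.fromℕ N) _) ⟩
      V * K.fromℕ N                                            ∎

    σ : F.Carrier → F.Carrier → F.Carrier
    σ y z = F.1# F.+ y F.+ z F.+ F.inv y F.* (F.inv z F.* arg)

    rescale : ∀ {x y z} → x F.≉ F.0# → y F.≉ F.0# → z F.≉ F.0# →
              x F.+ x F.* y F.+ x F.* z F.+ v x (x F.* y) (x F.* z) F.≈ x F.* σ y z
    rescale {x} {y} {z} x≉0 y≉0 z≉0 = F.trans (F.+-congˡ v≈) (F′.solve 5 (λ X Y Z iY t →
        X :+ X :* Y :+ X :* Z :+ X :* (iY :* t) := X :* (:1 :+ Y :+ Z :+ iY :* t)) F.refl x y z (F.inv y) (F.inv z F.* arg))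
      where
      open F′ using (_:=_; _:*_; _:+_; :1)
      v≈ : v x (x F.* y) (x F.* z) F.≈ x F.* (F.inv y F.* (F.inv z F.* arg))
      v≈ = F.trans (F.*-congˡ (F.*-cong (F′.inv-distrib-* x≉0 y≉0) (F.*-congʳ (F′.inv-distrib-* x≉0 z≉0))))
           (F.trans (F′.solve 5 (λ X i iy iz a → (X :* (X :* (X :* :1))) :* ((i :* iy) :* ((i :* iz) :* a))
                                  := (X :* i) :* ((X :* i) :* (X :* (iy :* (iz :* a))))) F.refl x (F.inv x) (F.inv y) (F.inv z) arg)
           (F.trans (F.*-cong (F.inv-r x x≉0) (F.*-congʳ (F.inv-r x x≉0))) (F.trans (F.*-identityˡ _) (F.*-identityˡ _))))

    V≈∑ˣψ[xσ] : V ≈ ∑ˣ λ x → ∑ˣ λ y → ∑ˣ λ z → ψ (x F.* σ y z)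
    V≈∑ˣψ[xσ] = ∑ˣ-cong λ x x≉0 → begin
      ∑ˣ (λ y → ∑ˣ λ z → ψ (x F.+ y F.+ z F.+ v x y z))
        ≈⟨ K.sym (∑ˣ-scale x≉0 _ (λ y≉0 y≈y′ → ∑ˣ-cong λ z z≉0 → ψ-cong (F.+-cong (F.+-congʳ (F.+-congˡ y≈y′))
                    (F.*-congˡ (F.*-congʳ (F′.inv-cong y≉0 y≈y′)))))) ⟩
      ∑ˣ (λ y → ∑ˣ λ z → ψ (x F.+ x F.* y F.+ z F.+ v x (x F.* y) z))
        ≈⟨ ∑ˣ-cong (λ y y≉0 → K.trans (K.sym (∑ˣ-scale x≉0 _ (λ z≉0 z≈z′ → ψ-cong (F.+-cong (F.+-congˡ z≈z′)
                    (F.*-congˡ (F.*-congˡ (F.*-congʳ (F′.inv-cong z≉0 z≈z′))))))))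
                  (∑ˣ-cong λ z z≉0 → ψ-cong (rescale x≉0 y≉0 z≉0))) ⟩
      ∑ˣ (λ y → ∑ˣ λ z → ψ (x F.* σ y z)) ∎

    Aσ : K.Carrier
    Aσ = ∑ˣ λ y → ∑ˣ λ z → [ σ y z F.≟ F.0# ]

    V≈Aσ*q-N*N : V ≈ Aσ * K.fromℕ q - K.fromℕ N * (K.fromℕ N * 1#)
    V≈Aσ*q-N*N = begin
      V                                             ≈⟨ V≈∑ˣψ[xσ] ⟩
      (∑ˣ λ x → ∑ˣ λ y → ∑ˣ λ z → ψ (x F.* σ y z))   ≈⟨ ∑ˣ-swap (λ x y → ∑ˣ λ z → ψ (x F.* σ y z)) ⟩
      (∑ˣ λ y → ∑ˣ λ x → ∑ˣ λ z → ψ (x F.* σ y z))   ≈⟨ ∑ˣ-cong (λ y _ → ∑ˣ-swap (λ x z → ψ (x F.* σ y z))) ⟩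
      (∑ˣ λ y → ∑ˣ λ z → ∑ˣ λ x → ψ (x F.* σ y z))   ≈⟨ ∑ˣ-cong (λ y _ → ∑ˣ-cong λ z _ → ∑ˣψ-scaled (σ y z)) ⟩
      (∑ˣ λ y → ∑ˣ λ z → [ σ y z F.≟ F.0# ] * K.fromℕ q - 1#)
        ≈⟨ ∑ˣ-cong (λ y _ → ∑ˣ-affine (λ z → [ σ y z F.≟ F.0# ]) (K.fromℕ q) 1#) ⟩
      (∑ˣ λ y → (∑ˣ λ z → [ σ y z F.≟ F.0# ]) * K.fromℕ q - K.fromℕ N * 1#)
        ≈⟨ ∑ˣ-affine (λ y → ∑ˣ λ z → [ σ y z F.≟ F.0# ]) (K.fromℕ q) (K.fromℕ N * 1#) ⟩
      Aσ * K.fromℕ q - K.fromℕ N * (K.fromℕ N * 1#)  ∎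

    cubic : F.Carrier → F.Carrier → F.Carrier
    cubic y z = y F.* z F.* (F.1# F.+ y F.+ z)

    A : K.Carrier
    A = ∑ˣ λ y → ∑ˣ λ z → [ cubic y z F.≟ lam ]

    Aσ≈A : Aσ ≈ A
    Aσ≈A = ∑ˣ-cong λ y y≉0 → ∑ˣ-cong λ z z≉0 →
             []-cong (σ y z F.≟ F.0#) (cubic y z F.≟ lam) (σ≈0⇒cubic≈lam y≉0 z≉0) (cubic≈lam⇒σ≈0 y≉0 z≉0)
      where
      open F′ using (_:=_; _:*_; _:+_; _:-_; :1)
      yzσ : ∀ {y z} → y F.≉ F.0# → z F.≉ F.0# → (y F.* z) F.* σ y z F.≈ cubic y z F.+ arg
      yzσ {y} {z} y≉0 z≉0 = F.trans
        (F′.solve 5 (λ Y Z iY iZ a → (Y :* Z) :* (:1 :+ Y :+ Z :+ iY :* (iZ :* a))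
                                     := Y :* Z :* (:1 :+ Y :+ Z) :+ (Y :* iY) :* ((Z :* iZ) :* a))
                    F.refl y z (F.inv y) (F.inv z) arg)
        (F.+-congˡ (F.trans (F.*-cong (F.inv-r y y≉0) (F.*-congʳ (F.inv-r z z≉0))) (F.trans (F.*-identityˡ _) (F.*-identityˡ _))))
      σ≈0⇒cubic≈lam : ∀ {y z} → y F.≉ F.0# → z F.≉ F.0# → σ y z F.≈ F.0# → cubic y z F.≈ lam
      σ≈0⇒cubic≈lam {y} {z} y≉0 z≉0 σ≈0 =
        F.trans (F′.solve 2 (λ p a → p := (p :+ a) :- a) F.refl (cubic y z) arg)
        (F.trans (F.+-cong (F.trans (F.sym (yzσ y≉0 z≉0)) (F.trans (F.*-congˡ σ≈0) (F.zeroʳ _))) (F.-‿cong arg≈-lam))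
                 (F.trans (F.+-identityˡ _) (F′.-‿involutive lam)))
      cubic≈lam⇒σ≈0 : ∀ {y z} → y F.≉ F.0# → z F.≉ F.0# → cubic y z F.≈ lam → σ y z F.≈ F.0#
      cubic≈lam⇒σ≈0 y≉0 z≉0 cubic≈lam =
        F′.x*y≈0⇒y≈0 (F′.*-nonzero y≉0 z≉0) (F.trans (yzσ y≉0 z≉0) (F.trans (F.+-cong cubic≈lam arg≈-lam) (F.-‿inverseʳ lam)))

    onCurve : ∀ X Y → Dec ((Y F.* Y) F.+ (X F.* Y) F.+ Y F.≈ lam F.* (X F.* X F.* X))
    onCurve X Y = ((Y F.* Y) F.+ (X F.* Y) F.+ Y) F.≟ (lam F.* (X F.* X F.* X))

    onCurve-cong : ∀ {X X′ Y Y′} → X F.≈ X′ → Y F.≈ Y′ → [ onCurve X Y ] ≈ [ onCurve X′ Y′ ]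
    onCurve-cong {X} {X′} {Y} {Y′} X≈X′ Y≈Y′ = []-cong (onCurve _ _) (onCurve _ _) (λ e → F.trans (F.sym lhs≈) (F.trans e rhs≈))
                                                                  (λ e → F.trans lhs≈ (F.trans e (F.sym rhs≈)))
      where
      lhs≈ : (Y F.* Y) F.+ (X F.* Y) F.+ Y F.≈ (Y′ F.* Y′) F.+ (X′ F.* Y′) F.+ Y′
      lhs≈ = F.+-cong (F.+-cong (F.*-cong Y≈Y′ Y≈Y′) (F.*-cong X≈X′ Y≈Y′)) Y≈Y′
      rhs≈ : lam F.* (X F.* X F.* X) F.≈ lam F.* (X′ F.* X′ F.* X′)
      rhs≈ = F.*-congˡ (F.*-cong (F.*-cong X≈X′ X≈X′) X≈X′)

    pointCount≈1+∑∑ : K.fromℕ (pointCount F K lam) ≈ 1# + ∑ (λ X → ∑ (λ Y → [ onCurve X Y ]))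
    pointCount≈1+∑∑ = K.+-congˡ (begin
      K.fromℕ (length (filter P? (cartesianProduct F.elements F.elements)))
        ≈⟨ fromℕ-length-filter P? (cartesianProduct F.elements F.elements) ⟩
      K.sumL (map (λ p → [ P? p ]) (cartesianProduct F.elements F.elements))
        ≈⟨ sumL-cartesianProduct (λ p → [ P? p ]) F.elements F.elements ⟩
      K.sumL (map (λ X → K.sumL (map (λ Y → [ onCurve X Y ]) F.elements)) F.elements)
        ≈⟨ K.trans (sumL-cong F.elements (λ X → sumL-elements _)) (sumL-elements _) ⟩
      ∑ (λ X → ∑ (λ Y → [ onCurve X Y ])) ∎)
      where
      P? : (p : F.Carrier × F.Carrier) → Dec _
      P? (X , Y) = onCurve X Y
      sumL-cong : ∀ xs {f g : F.Carrier → K.Carrier} → (∀ x → f x ≈ g x) → K.sumL (map f xs) ≈ K.sumL (map g xs)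
      sumL-cong []       f≈g = K.refl
      sumL-cong (x ∷ xs) f≈g = K.+-cong (f≈g x) (sumL-cong xs f≈g)

    onCurve-0 : ∀ Y → [ onCurve F.0# Y ] ≈ [ Y F.≟ F.0# ] * 1# + [ Y F.≟ (F.- F.1#) ] * 1#
    onCurve-0 Y = by-cases (Y F.≟ F.0#) (Y F.≟ (F.- F.1#))
      where
      open F′ using (_:=_; _:*_; _:+_; _:-_; con; :1)
      lhs≈ : (Y F.* Y) F.+ (F.0# F.* Y) F.+ Y F.≈ Y F.* (Y F.+ F.1#)
      lhs≈ = F′.solve 1 (λ y → y :* y :+ con (+ 0) :* y :+ y := y :* (y :+ :1)) F.refl Y
      rhs≈0 : lam F.* (F.0# F.* F.0# F.* F.0#) F.≈ F.0#
      rhs≈0 = F.trans (F.*-congˡ (F.zeroʳ _)) (F.zeroʳ lam)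
      on⇔ : (Y F.* (Y F.+ F.1#) F.≈ F.0# → _) × (_ → Y F.* (Y F.+ F.1#) F.≈ F.0#)
      on⇔ = (λ e → F.trans lhs≈ (F.trans e (F.sym rhs≈0))) , (λ e → F.trans (F.sym lhs≈) (F.trans e rhs≈0))
      -1≉0 : F.- F.1# F.≉ F.0#
      -1≉0 e = F′.1≉0 (F.trans (F.sym (F′.-‿involutive F.1#)) (F.trans (F.-‿cong e) F′.-0#≈0#))
      Y+1≈0⇒Y≈-1 : Y F.+ F.1# F.≈ F.0# → Y F.≈ F.- F.1#
      Y+1≈0⇒Y≈-1 e = F.trans (F′.solve 1 (λ y → y := (y :+ :1) :- :1) F.refl Y) (F.trans (F.+-congʳ e) (F.+-identityˡ _))
      by-cases : Dec (Y F.≈ F.0#) → Dec (Y F.≈ F.- F.1#) → [ onCurve F.0# Y ] ≈ [ Y F.≟ F.0# ] * 1# + [ Y F.≟ (F.- F.1#) ] * 1#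
      by-cases (yes Y≈0) _ = K.trans ([]-yes (onCurve F.0# Y) (proj₁ on⇔ (F.trans (F.*-congʳ Y≈0) (F.zeroˡ _)))) (K.sym (begin
        [ Y F.≟ F.0# ] * 1# + [ Y F.≟ (F.- F.1#) ] * 1# ≈⟨ K.+-cong (K.*-congʳ ([]-yes (Y F.≟ F.0#) Y≈0)) (K.*-congʳ ([]-no (Y F.≟ (F.- F.1#)) (λ Y≈-1 → -1≉0 (F.trans (F.sym Y≈-1) Y≈0)))) ⟩
        1# * 1# + 0# * 1#                               ≈⟨ K.trans (K.+-cong (K.*-identityˡ 1#) (K.zeroˡ 1#)) (K.+-identityʳ 1#) ⟩
        1#                                              ∎))
      by-cases (no Y≉0) (yes Y≈-1) = K.trans ([]-yes (onCurve F.0# Y) (proj₁ on⇔ Y[Y+1]≈0)) (K.sym (begin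
        [ Y F.≟ F.0# ] * 1# + [ Y F.≟ (F.- F.1#) ] * 1# ≈⟨ K.+-cong (K.*-congʳ ([]-no (Y F.≟ F.0#) Y≉0)) (K.*-congʳ ([]-yes (Y F.≟ (F.- F.1#)) Y≈-1)) ⟩
        0# * 1# + 1# * 1#                               ≈⟨ K.trans (K.+-cong (K.zeroˡ 1#) (K.*-identityˡ 1#)) (K.+-identityˡ 1#) ⟩
        1#                                              ∎))
        where
        Y[Y+1]≈0 : Y F.* (Y F.+ F.1#) F.≈ F.0#
        Y[Y+1]≈0 = F.trans (F.*-congˡ (F.trans (F.+-congʳ Y≈-1) (F.-‿inverseˡ F.1#))) (F.zeroʳ Y)
      by-cases (no Y≉0) (no Y≉-1) = K.trans ([]-no (onCurve F.0# Y) (λ on → Y≉-1 (Y+1≈0⇒Y≈-1 (F′.x*y≈0⇒y≈0 Y≉0 (proj₂ on⇔ on))))) (K.sym (begin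
        [ Y F.≟ F.0# ] * 1# + [ Y F.≟ (F.- F.1#) ] * 1# ≈⟨ K.+-cong (K.*-congʳ ([]-no (Y F.≟ F.0#) Y≉0)) (K.*-congʳ ([]-no (Y F.≟ (F.- F.1#)) Y≉-1)) ⟩
        0# * 1# + 0# * 1#                               ≈⟨ K.trans (K.+-cong (K.zeroˡ 1#) (K.zeroˡ 1#)) (K.+-identityˡ 0#) ⟩
        0#                                              ∎))

    cubic-cong : ∀ {b b′ a a′} → b F.≈ b′ → a F.≈ a′ → [ cubic b a F.≟ lam ] ≈ [ cubic b′ a′ F.≟ lam ]
    cubic-cong b≈b′ a≈a′ = []-cong (_ F.≟ lam) (_ F.≟ lam) (F.trans (F.sym cubic≈)) (F.trans cubic≈)
      where cubic≈ = F.*-cong (F.*-cong b≈b′ a≈a′) (F.+-cong (F.+-congˡ b≈b′) a≈a′)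

    onCurve⇔cubic : ∀ {X} → X F.≉ F.0# → ∀ a → [ onCurve X (X F.* a) ] ≈ [ cubic (F.inv X) a F.≟ lam ]
    onCurve⇔cubic {X} X≉0 a = []-cong (onCurve X (X F.* a)) (cubic (F.inv X) a F.≟ lam)
      (λ on → F′.*-cancelˡ X³≉0 (F.trans (F.sym (scaled a)) (F.trans on (F.*-comm lam X³))))
      (λ c≈lam → F.trans (scaled a) (F.trans (F.*-congˡ c≈lam) (F.*-comm X³ lam)))
      where
      open F′ using (_:=_; _:*_; _:+_; :1)
      X³ : F.Carrier
      X³ = X F.* X F.* X
      X³≉0 : X³ F.≉ F.0#
      X³≉0 = F′.*-nonzero (F′.*-nonzero X≉0 X≉0) X≉0
      scaled : ∀ a → (X F.* a) F.* (X F.* a) F.+ X F.* (X F.* a) F.+ X F.* a F.≈ X³ F.* cubic (F.inv X) a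
      scaled a = F.sym (F.trans
        (F′.solve 3 (λ x i y → ((x :* x) :* x) :* ((i :* y) :* ((:1 :+ i) :+ y))
                              := (x :* i) :* (x :* x :* y :+ (x :* i) :* (x :* y) :+ x :* x :* (y :* y))) F.refl X (F.inv X) a)
        (F.trans (F.*-cong (F.inv-r X X≉0) (F.+-congʳ (F.+-congˡ (F.*-congʳ (F.inv-r X X≉0)))))
        (F′.solve 2 (λ x y → :1 :* (x :* x :* y :+ :1 :* (x :* y) :+ x :* x :* (y :* y))
                             := (x :* y) :* (x :* y) :+ x :* (x :* y) :+ x :* y) F.refl X a)))

    cubic-0 : ∀ b → [ cubic b F.0# F.≟ lam ] ≈ 0#
    cubic-0 b = []-no (_ F.≟ lam) (λ c≈lam → lam≉0 (F.trans (F.sym c≈lam) (F.trans (F.*-congʳ (F.zeroʳ b)) (F.zeroˡ _))))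

    ∑∑onCurve≈2+A : ∑ (λ X → ∑ (λ Y → [ onCurve X Y ])) ≈ 1# + (1# + A)
    ∑∑onCurve≈2+A = begin
      ∑ (λ X → ∑ (λ Y → [ onCurve X Y ]))
        ≈⟨ ∑≈f0+∑ˣ _ (λ X≈X′ → ∑-cong (λ Y → onCurve-cong X≈X′ F.refl)) ⟩
      ∑ (λ Y → [ onCurve F.0# Y ]) + ∑ˣ (λ X → ∑ (λ Y → [ onCurve X Y ]))
        ≈⟨ K.+-cong ∑onCurve-0 (∑ˣ-cong λ X X≉0 → K.trans (K.sym (∑-scale X≉0 _ (onCurve-cong F.refl))) (∑-cong (onCurve⇔cubic X≉0))) ⟩
      (1# + 1#) + ∑ˣ (λ X → ∑ (λ a → [ cubic (F.inv X) a F.≟ lam ]))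
        ≈⟨ K.+-congˡ (∑ˣ-inv (λ b → ∑ (λ a → [ cubic b a F.≟ lam ])) (λ _ b≈b′ → ∑-cong (λ a → cubic-cong b≈b′ F.refl))) ⟩
      (1# + 1#) + ∑ˣ (λ b → ∑ (λ a → [ cubic b a F.≟ lam ]))
        ≈⟨ K.+-congˡ (∑ˣ-cong λ b _ → K.trans (∑≈f0+∑ˣ _ (cubic-cong F.refl)) (K.trans (K.+-congʳ (cubic-0 b)) (K.+-identityˡ _))) ⟩
      (1# + 1#) + A                                   ≈⟨ K.+-assoc _ _ _ ⟩
      1# + (1# + A)                                   ∎
      where
      ∑onCurve-0 : ∑ (λ Y → [ onCurve F.0# Y ]) ≈ 1# + 1#
      ∑onCurve-0 = K.trans (∑-cong onCurve-0)
                   (K.trans (∑-distrib _ _) (K.+-cong (∑-δ F.0# (λ _ → 1#) (λ _ → K.refl)) (∑-δ (F.- F.1#) (λ _ → 1#) (λ _ → K.refl))))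

    term : ℕ → K.Carrier
    term m = (K.fromℕ q K.^ᶻ (+ s F K ψc ωc m ℤ.- + s F K ψc ωc 0)) * gauss F K ψc ωc (+ (3 ℕ.* m))
             * (gauss F K ψc ωc (ℤ.- (+ m)) ^ 3) * (ω arg ^ m)

    H≡ : H F K ψc ωc (F.fromℕ 27 F.* lam) ≡ K.inv (1# - K.fromℕ q) * sum {N} (λ j → term (Fin.toℕ j))
    H≡ = ≡.cong (K.inv (1# - K.fromℕ q) *_) (sumL-map-applyUpTo term (λ m → m) N)

    s-0 : s F K ψc ωc 0 ≡ 1
    s-0 = ≡.cong (λ b → if b then 1 else 0) (dec-true (N ∣? 0) (N ∣0))

    s-suc : ∀ k → suc k ℕ.< N → s F K ψc ωc (suc k) ≡ 0
    s-suc k k<N = ≡.cong (λ b → if b then 1 else 0) (dec-false (N ∣? suc k) (λ N∣ → ℕ.<⇒≱ k<N (∣⇒≤ N∣)))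

    term-0 : term 0 ≈ W 0
    term-0 rewrite s-0 = K.*-congʳ (K.*-congʳ (K.*-identityˡ _))

    term-suc : ∀ k → suc k ℕ.< N → term (suc k) ≈ K.inv (K.fromℕ q) * W (suc k)
    term-suc k k<N rewrite s-0 | s-suc k k<N =
      K′.solve 4 (λ i a b c → ((i :* :1) :* a) :* b :* c := i :* ((a :* b) :* c)) K.refl (K.inv (K.fromℕ q)) _ _ _
      where open K′ using (_:=_; _:*_; :1)

    W-0 : W 0 ≈ 1#
    W-0 = K.trans (K.*-congʳ (K.*-cong gauss-0 (K′.^-cong 3 gauss-0)))
                  (K′.solve 0 (((:- :1) :* ((:- :1) :* ((:- :1) :* ((:- :1) :* :1)))) :* :1 := :1) K.refl)
      where open K′ using (_:=_; _:*_; :-_; :1)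

    ∑term≈ : sum {N} (λ j → term (Fin.toℕ j)) ≈ (1# - K.fromℕ q) * (K.fromℕ N - 1# - A)
    ∑term≈ = begin
      term 0 + sum {n} (λ j → term (suc (Fin.toℕ j)))
        ≈⟨ K.+-cong (K.trans term-0 W-0) (sum-cong-≋ {n} (λ j → term-suc (Fin.toℕ j) (ℕ.s≤s (toℕ<n j)))) ⟩
      1# + sum {n} (λ j → q⁻¹ * W (suc (Fin.toℕ j)))     ≈⟨ K.+-congˡ (K.sym (*-distribˡ-sum {n} q⁻¹ (λ j → W (suc (Fin.toℕ j))))) ⟩
      1# + q⁻¹ * Wᵣ                                    ≈⟨ K.+-congˡ (K.*-congˡ Wᵣ≈) ⟩
      1# + q⁻¹ * ((A * Q - Nₖ * (Nₖ * 1#)) * Nₖ - 1#)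
        ≈⟨ K.+-congˡ (K.*-congˡ (K′.solve 2 (λ a m → ((a :* (:1 :+ m) :- m :* (m :* :1)) :* m) :- :1
                                                   := (:1 :+ m) :* (m :* a :- m :* m :+ m :- :1)) K.refl A Nₖ)) ⟩
      1# + q⁻¹ * (Q * Y)                               ≈⟨ K.+-congˡ (K.trans (K.sym (K.*-assoc _ _ _)) (K.trans (K.*-congʳ (K′.inv-l Q (K.char0 N))) (K.*-identityˡ Y))) ⟩
      1# + Y                                           ≈⟨ K′.solve 2 (λ a m → :1 :+ (m :* a :- m :* m :+ m :- :1) := (:1 :- (:1 :+ m)) :* (m :- :1 :- a)) K.refl A Nₖ ⟩
      (1# - Q) * (Nₖ - 1# - A)                          ∎
      where
      open K′ using (_:=_; _:*_; _:+_; _:-_; :1)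
      Q Nₖ q⁻¹ Y Wᵣ : K.Carrier
      Q = K.fromℕ q
      Nₖ = K.fromℕ N
      q⁻¹ = K.inv Q
      Y = Nₖ * A - Nₖ * Nₖ + Nₖ - 1#
      Wᵣ = sum {n} (λ j → W (suc (Fin.toℕ j)))
      Wᵣ≈ : Wᵣ ≈ (A * Q - Nₖ * (Nₖ * 1#)) * Nₖ - 1#
      Wᵣ≈ = begin
        Wᵣ                                 ≈⟨ K′.solve 2 (λ w r → r := (w :+ r) :- w) K.refl (W 0) Wᵣ ⟩
        (W 0 + Wᵣ) - W 0                   ≈⟨ K.+-cong ∑W≈V*N (K.-‿cong W-0) ⟩
        V * Nₖ - 1#                        ≈⟨ K.+-congʳ (K.*-congʳ (K.trans V≈Aσ*q-N*N (K.+-congʳ (K.*-congʳ Aσ≈A)))) ⟩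
        (A * Q - Nₖ * (Nₖ * 1#)) * Nₖ - 1# ∎

    H≈N-1-A : H F K ψc ωc (F.fromℕ 27 F.* lam) ≈ K.fromℕ N - 1# - A
    H≈N-1-A = begin
      H F K ψc ωc (F.fromℕ 27 F.* lam)                            ≡⟨ H≡ ⟩
      K.inv (1# - K.fromℕ q) * sum {N} (λ j → term (Fin.toℕ j))   ≈⟨ K.*-congˡ ∑term≈ ⟩
      K.inv (1# - K.fromℕ q) * ((1# - K.fromℕ q) * (K.fromℕ N - 1# - A))
        ≈⟨ K.trans (K.sym (K.*-assoc _ _ _)) (K.trans (K.*-congʳ (K′.inv-l _ 1-q≉0)) (K.*-identityˡ _)) ⟩
      K.fromℕ N - 1# - A                                          ∎
      where
      open K′ using (_:=_; _:+_; _:-_; :-_; :1)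
      1-q≉0 : 1# - K.fromℕ q K.≉ 0#
      1-q≉0 1-q≈0 = K.char0 n (K.trans (K′.solve 1 (λ m → m := :- (:1 :- (:1 :+ m))) K.refl (K.fromℕ N))
                                        (K.trans (K.-‿cong 1-q≈0) K′.-0#≈0#))

    pointCount≈q+1-H : K.fromℕ (pointCount F K lam) ≈ (K.fromℕ q + 1#) - H F K ψc ωc (F.fromℕ 27 F.* lam)
    pointCount≈q+1-H = begin
      K.fromℕ (pointCount F K lam)                        ≈⟨ pointCount≈1+∑∑ ⟩
      1# + ∑ (λ X → ∑ (λ Y → [ onCurve X Y ]))            ≈⟨ K.+-congˡ ∑∑onCurve≈2+A ⟩
      1# + (1# + (1# + A))                                ≈⟨ K′.solve 2 (λ a m → :1 :+ (:1 :+ (:1 :+ a)) := ((:1 :+ m) :+ :1) :- (m :- :1 :- a)) K.refl A (K.fromℕ N) ⟩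
      (K.fromℕ q + 1#) - (K.fromℕ N - 1# - A)             ≈⟨ K.+-congˡ (K.-‿cong (K.sym H≈N-1-A)) ⟩
      (K.fromℕ q + 1#) - H F K ψc ωc (F.fromℕ 27 F.* lam) ∎
      where open K′ using (_:=_; _:+_; _:-_; :1)

open import Data.Nat using (_^_)
open import Data.Nat.Primality using (Prime)
open import Data.Product using (Σ)

corollary1p7 : (q : ℕ) →
    (Σ ℕ λ p → Σ ℕ λ k → Prime p × q ≡ p ^ suc k) →
    ¬ (2 ∣ q) → ¬ (3 ∣ q) →
    (F : FiniteField q) (K : Char0Field)
    (ψ : AddChar F K) (ω : MulCharGen F K) →
    let module F = FiniteField F
        module K = Char0Field K
    in (lam : F.Carrier) → ¬ (lam F.≈ F.0#) →
       ¬ ((F.fromℕ 27 F.* lam) F.≈ F.1#) →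
       K.fromℕ (pointCount F K lam)
         K.≈ (K.fromℕ q K.+ K.1#) K.- H F K ψ ω (F.fromℕ 27 F.* lam)
corollary1p7 zero _ _ _ F _ _ _ _ _ _ with () ← proj₁ (FiniteField.enum-surj F (FiniteField.0# F))
corollary1p7 (suc zero) _ _ _ F _ _ _ _ _ _ = ⊥-elim (F.0≉1 (F.trans (F.sym (enum0≈ F.0#)) (enum0≈ F.1#)))
  where
  module F = FiniteField F
  enum0≈ : ∀ x → F.enum Fin.zero F.≈ x
  enum0≈ x with F.enum-surj x
  ... | Fin.zero , e = e
corollary1p7 (suc (suc n)) _ _ 3∤q F K ψ ω lam lam≉0 _ =
  CurvePointCount.pointCount≈q+1-H n F K ψ ω lam lam≉0 (λ 3≈0 → 3∤q (OrbitsOfLengthThree.fromℕ3≈0⇒3∣size F 3≈0))
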